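{- Let $k\ge0$ and $n=k+2$. If $n$ is even, then $\Theta_e(n)$ and $\Lambda_e(n)$ belong to the clean compact peg basis of both $\hat B_k^{(prd)}$ and $\hat B_{k+1}^{(prd)}$. If $n$ is odd, then $\Theta_o(n)$ and $\Lambda_o(n)$ belong to the clean compact peg basis of both $\hat B_k^{(prd)}$ and $\hat B_{k+1}^{(prd)}$.
   Context: A peg permutation of length $n$ is a word $\pi_1^{\varepsilon_1}\cdots\pi_n^{\varepsilon_n}$ with $\pi_1\cdots\pi_n$ a permutation of $\{1,\dots,n\}$ in one-line notation and $\varepsilon_i\in\{+,-,\bullet\}$. An increasing (resp. decreasing) strip is a maximal factor of consecutive positions in which each value is one more (resp. one less) than the previous and all entries are decorated $+$ or $\bullet$ (resp. $-$ or $\bullet$); clean compact means all strips have length $1$. A prefix reversal reverses a prefix and swaps $+\leftrightarrow-$ on the reversed entries ($\bullet$ unchanged); $prd(\pi^\varepsilon)$ is the minimum number of prefix reversals turning $\pi^\varepsilon$ into a peg permutation with identity underlying permutation and decorations in $\{+,\bullet\}$; $\hat B_k^{(prd)}$ is the set of peg permutations with $prd\le k$. Peg pattern order: $\sigma^\delta$ of length $m$ is a pattern of $\tau^\varepsilon$ if there are $i_1<\dots<i_m$ with $\tau_{i_1}\cdots\tau_{i_m}$ order-isomorphic to $\sigma$ and, for each $j$, $\delta_j\in\{+,-\}$ implies $\varepsilon_{i_j}=\delta_j$. The clean compact peg basis of a pattern-closed set $X$ is the set of clean compact peg permutations not in $X$ all of whose proper clean compact patterns lie in $X$. Exceptional permutations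 (all decorations $\bullet$ except the one indicated): for $n$ even, $\Theta_e(n)=n^\bullet(n-2)^\bullet\cdots4^\bullet2^\bullet\,1^+\,3^\bullet5^\bullet\cdots(n-1)^\bullet$, and with $t=n/2$, $\Lambda_e(n)$ has entries $t+j,\,t+1-j$ at positions $2j-1,2j$ ($j=1,\dots,t$), the first entry $(t+1)$ decorated $+$. For $n$ odd, $\Theta_o(n)=n^\bullet(n-2)^\bullet\cdots3^\bullet\,1^-\,2^\bullet4^\bullet\cdots(n-1)^\bullet$, and with $t=(n+1)/2$, $\Lambda_o(n)=t^-\,(t+1)^\bullet(t-1)^\bullet(t+2)^\bullet(t-2)^\bullet\cdots n^\bullet1^\bullet$ (first $t$, then the pairs $t+j,t-j$ for $j=1,\dots,(n-1)/2$). -}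

module Defs where

open import Data.Nat using (ℕ; zero; suc; _+_; _*_; _∸_; _<_; ⌊_/2⌋)
open import Data.Product using (Σ; ∃; _×_; _,_; proj₁; proj₂)
open import Data.List using (List; []; _∷_; _++_; map; reverse; take; drop; length; upTo; applyUpTo; concatMap; [_])
open import Data.List.Relation.Unary.All using (All)
open import Data.List.Relation.Unary.Linked using (Linked)
open import Data.List.Relation.Binary.Pointwise using (Pointwise)
open import Data.List.Relation.Binary.Sublist.Propositional using (_⊆_)
open import Data.List.Relation.Binary.Permutation.Propositional using (_↭_)
open import Relation.Binary.PropositionalEquality using (_≡_; _≢_)
open import Relation.Nullary using (¬_)
open import Function.Bundles using (_⇔_)
open import Data.Unit using (⊤)
open import Data.Sum using (_⊎_)

data Deco : Set where
  plus minus dot : Deco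

Peg : Set
Peg = List (ℕ × Deco)

vals : Peg → List ℕ
vals = map proj₁

decos : Peg → List Deco
decos = map proj₂

oneTo : ℕ → List ℕ
oneTo n = map suc (upTo n)

IsPeg : Peg → Set
IsPeg w = vals w ↭ oneTo (length w)

flipD : Deco → Deco
flipD plus  = minus
flipD minus = plus
flipD dot   = dot

flipE : ℕ × Deco → ℕ × Deco
flipE (v , d) = (v , flipD d)

prefRev : ℕ → Peg → Peg
prefRev i w = reverse (map flipE (take i w)) ++ drop i w

NotMinus : Deco → Set
NotMinus d = d ≢ minus

IsSortedPeg : Peg → Set
IsSortedPeg w = (vals w ≡ oneTo (length w)) × All NotMinus (decos w)

-- ReachIn k w : w can be turned into a sorted peg permutation by at most k
-- prefix reversals  (i.e.  prd(w) ≤ k)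
data ReachIn : ℕ → Peg → Set where
  done : ∀ {k w} → IsSortedPeg w → ReachIn k w
  step : ∀ {k w} (i : ℕ) → ReachIn k (prefRev i w) → ReachIn (suc k) w

InB : ℕ → Peg → Set
InB k w = IsPeg w × ReachIn k w

IncOK DecOK : Deco → Set
IncOK d = d ≢ minus
DecOK d = d ≢ plus

-- two adjacent entries form (part of) a strip of length ≥ 2
StripPair : ℕ × Deco → ℕ × Deco → Set
StripPair (a , d) (b , e) =
  (∃ λ (_ : b ≡ suc a) → IncOK d × IncOK e) ⊎
  (∃ λ (_ : a ≡ suc b) → DecOK d × DecOK e)

-- all strips have length 1
CleanCompact : Peg → Set
CleanCompact = Linked (λ x y → ¬ StripPair x y)

data OrdIso : List ℕ → List ℕ → Set where
  []  : OrdIso [] []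
  _∷_ : ∀ {x y xs ys} →
        Pointwise (λ a b → ((x < a) ⇔ (y < b)) × ((a < x) ⇔ (b < y))) xs ys →
        OrdIso xs ys → OrdIso (x ∷ xs) (y ∷ ys)

DecoCompat : Deco → Deco → Set
DecoCompat plus  e = e ≡ plus
DecoCompat minus e = e ≡ minus
DecoCompat dot   e = ⊤

_≼_ : Peg → Peg → Set
σ ≼ τ = ∃ λ (s : Peg) → (s ⊆ τ) × OrdIso (vals σ) (vals s)
                              × Pointwise DecoCompat (decos σ) (decos s)

InCCBasis : ℕ → Peg → Set
InCCBasis k π =
  IsPeg π × CleanCompact π × ¬ InB k π ×
  (∀ σ → IsPeg σ → CleanCompact σ → length σ < length π → σ ≼ π → InB k σ)

-- n even, t = n/2 :  n (n-2) ... 4 2 1^+ 3 5 ... (n-1)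
Θe : ℕ → Peg
Θe n = applyUpTo (λ j → (2 * (t ∸ j) , dot)) t
       ++ (1 , plus) ∷ applyUpTo (λ j → (2 * j + 3 , dot)) (t ∸ 1)
  where t = ⌊ n /2⌋

-- n even, t = n/2 : positions 2j-1, 2j carry t+j, t+1-j ; first entry decorated +
Λe : ℕ → Peg
Λe n = (suc t , plus) ∷ (t , dot)
       ∷ concatMap (λ j → (t + suc (suc j) , dot) ∷ (t ∸ suc j , dot) ∷ []) (upTo (t ∸ 1))
  where t = ⌊ n /2⌋

-- n odd (n = 2s+1) :  n (n-2) ... 3 1^- 2 4 ... (n-1)
Θo : ℕ → Peg
Θo n = applyUpTo (λ j → (2 * (s ∸ j) + 1 , dot)) s
       ++ (1 , minus) ∷ applyUpTo (λ j → (2 * j + 2 , dot)) s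
  where s = ⌊ n /2⌋

-- n odd, t = (n+1)/2 :  t^- (t+1) (t-1) (t+2) (t-2) ... n 1
Λo : ℕ → Peg
Λo n = (t , minus) ∷ concatMap (λ j → (t + suc j , dot) ∷ (t ∸ suc j , dot) ∷ []) (upTo s)
  where s = ⌊ n /2⌋
        t = suc s

private
  open import Relation.Binary.PropositionalEquality using (refl)
  t1 : Θe 6 ≡ (6 , dot) ∷ (4 , dot) ∷ (2 , dot) ∷ (1 , plus) ∷ (3 , dot) ∷ (5 , dot) ∷ []
  t1 = refl
  t2 : Λe 6 ≡ (4 , plus) ∷ (3 , dot) ∷ (5 , dot) ∷ (2 , dot) ∷ (6 , dot) ∷ (1 , dot) ∷ []
  t2 = refl
  t3 : Θo 7 ≡ (7 , dot) ∷ (5 , dot) ∷ (3 , dot) ∷ (1 , minus) ∷ (2 , dot) ∷ (4 , dot) ∷ (6 , dot) ∷ []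
  t3 = refl
  t4 : Λo 7 ≡ (4 , minus) ∷ (5 , dot) ∷ (3 , dot) ∷ (6 , dot) ∷ (2 , dot) ∷ (7 , dot) ∷ (1 , dot) ∷ []
  t4 = refl
  t5 : Λe 2 ≡ (2 , plus) ∷ (1 , dot) ∷ []
  t5 = refl
  t6 : Θe 2 ≡ (2 , dot) ∷ (1 , plus) ∷ []
  t6 = refl

-- Lower bound: count the breakpoints of π followed by the sentinel (n+1)^+. A prefix reversal
-- changes this count by at most one and sorted words have none, while Θ and Λ of length
-- n = k + 2 have n of them; hence prd π ≥ k + 2, and π is clean compact since every adjacency
-- is a breakpoint.
-- Upper bound: both families are recursive, Θ(n+2) being (n+2)^• followed by the flipped reversal
-- of Θ(n+1), and Λ(n+3) being Λ(n+1) shifted up by one followed by (n+3)^• 1^•. A proper pattern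
-- either avoids the new entries, and then is a pattern of a word sortable with n − 2 reversals,
-- or uses them as its extreme values and reduces to a shorter pattern of the previous word at
-- the price of one (Θ) or two (Λ) reversals. Finally prd cannot grow when passing to a pattern:
-- a prefix reversal of a word induces a prefix reversal of each of its patterns.
module Submission where

open import Defs
open import Data.Nat using (ℕ; zero; suc; _+_; _*_; _∸_; _<_; _≤_; z≤n; s≤s; pred; _≟_; _≤?_; _%_; _/_)
open import Data.Nat.Properties
open import Data.Nat.DivMod using (m≡m%n+[m/n]*n; [m+n]%n≡m%n)
open import Data.Product using (∃-syntax; _×_; _,_; proj₁; proj₂)
open import Data.Sum using (_⊎_; inj₁; inj₂)
open import Data.Empty using (⊥-elim)
open import Data.Unit using (tt)
open import Data.List using (List; []; _∷_; _++_; map; reverse; take; drop; length; upTo; applyUpTo; applyDownFrom; concat; concatMap; zip; [_])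
open import Data.List.Properties
open import Data.List.Membership.Propositional using (_∈_)
open import Data.List.Membership.Propositional.Properties using (∈-++⁺ʳ)
open import Data.List.Relation.Unary.Any using (here; there)
open import Data.List.Relation.Unary.All as All using (All; []; _∷_)
import Data.List.Relation.Unary.All.Properties as All
open import Data.List.Relation.Unary.AllPairs as AllPairs using (AllPairs; []; _∷_)
import Data.List.Relation.Unary.AllPairs.Properties as AllPairs
open import Data.List.Relation.Unary.Linked using (Linked; []; [-]; _∷_)
import Data.List.Relation.Unary.Linked.Properties as Linked
open import Data.List.Relation.Unary.Sorted.TotalOrder.Properties using (↗↭↗⇒≋; AllPairs⇒Sorted)
open import Data.List.Relation.Binary.Pointwise using (Pointwise; []; _∷_)
open import Data.List.Relation.Binary.Equality.Propositional using (≋⇒≡)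
open import Data.List.Relation.Binary.Sublist.Propositional using (_⊆_; []; _∷_; _∷ʳ_; minimum; ⊆-trans; ⊆-reflexive)
import Data.List.Relation.Binary.Sublist.Propositional.Properties as Sub
open import Data.List.Relation.Binary.Permutation.Propositional
  using (_↭_; ↭-sym; ↭-trans; ↭-refl; ↭-swap; prep; ↭⇒↭ₛ; module PermutationReasoning)
import Data.List.Relation.Binary.Permutation.Propositional.Properties as Perm
open import Function.Base using (_∘_)
open import Function.Bundles using (_⇔_; mk⇔; Equivalence)
open import Function.Construct.Composition using (_⇔-∘_)
open import Function.Construct.Symmetry using (⇔-sym)
open import Relation.Binary.PropositionalEquality hiding ([_])
open import Relation.Nullary using (¬_; Dec; yes; no)
open import Relation.Nullary.Decidable using (_×-dec_; _⊎-dec_)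

module _ {A : Set} where

  take-++-≤ : ∀ i (u w : List A) → i ≤ length u → take i (u ++ w) ≡ take i u
  take-++-≤ zero    u       w _         = refl
  take-++-≤ (suc i) (e ∷ u) w (s≤s i≤u) = cong (e ∷_) (take-++-≤ i u w i≤u)

  drop-++-≤ : ∀ i (u w : List A) → i ≤ length u → drop i (u ++ w) ≡ drop i u ++ w
  drop-++-≤ zero    u       w _         = refl
  drop-++-≤ (suc i) (e ∷ u) w (s≤s i≤u) = drop-++-≤ i u w i≤u

  length-∷ʳ : ∀ (u : List A) x → length (u ++ [ x ]) ≡ suc (length u)
  length-∷ʳ u x = trans (length-++ u) (+-comm (length u) 1)

  All-reverse⁺ : ∀ {P : A → Set} {xs} → All P xs → All P (reverse xs)
  All-reverse⁺ {xs = xs} = Perm.All-resp-↭ (↭-sym (Perm.↭-reverse xs))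

  AllPairs-reverse⁺ : ∀ {R : A → A → Set} → (∀ {x y} → R x y → R y x) →
                      ∀ {xs} → AllPairs R xs → AllPairs R (reverse xs)
  AllPairs-reverse⁺ R-sym {[]}     []             = []
  AllPairs-reverse⁺ {R} R-sym {x ∷ xs} (x~xs ∷ pxs) =
    subst (AllPairs R) (sym (unfold-reverse x xs))
      (AllPairs.++⁺ (AllPairs-reverse⁺ R-sym pxs) ([] ∷ []) (All-reverse⁺ (All.map (λ r → R-sym r ∷ []) x~xs)))

  AllPairs-++⁻ : ∀ {R : A → A → Set} xs {ys} → AllPairs R (xs ++ ys) →
                 AllPairs R xs × AllPairs R ys × All (λ x → All (R x) ys) xs
  AllPairs-++⁻ []       pys          = [] , pys , []
  AllPairs-++⁻ (x ∷ xs) (x~ ∷ pxys) with AllPairs-++⁻ xs pxys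
  ... | pxs , pys , across = All.++⁻ˡ xs x~ ∷ pxs , pys , All.++⁻ʳ xs x~ ∷ across

  AllPairs-resp-⊆ : ∀ {R : A → A → Set} {xs ys} → xs ⊆ ys → AllPairs R ys → AllPairs R xs
  AllPairs-resp-⊆ []          []          = []
  AllPairs-resp-⊆ (_ ∷ʳ xs⊆) (_ ∷ pys)   = AllPairs-resp-⊆ xs⊆ pys
  AllPairs-resp-⊆ (refl ∷ xs⊆) (y~ ∷ pys) = Sub.All-resp-⊆ xs⊆ y~ ∷ AllPairs-resp-⊆ xs⊆ pys

  AllPairs-map-restricted : ∀ {P : A → Set} {R S : A → A → Set} (h : A → A) →
                            (∀ {x y} → P x → P y → R x y → S (h x) (h y)) →
                            ∀ {xs} → All P xs → AllPairs R xs → AllPairs S (map h xs)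
  AllPairs-map-restricted h h-mono {[]}     []         []          = []
  AllPairs-map-restricted h h-mono {x ∷ xs} (px ∷ pxs) (x~ ∷ rxs) =
    All.map⁺ (All.zipWith (λ (py , r) → h-mono px py r) (pxs , x~)) ∷ AllPairs-map-restricted h h-mono pxs rxs

  split-⊆-++ : ∀ {B : Set} (f : A → B) xs ys zs → map f xs ⊆ ys ++ zs →
               ∃[ xs₁ ] ∃[ xs₂ ] xs ≡ xs₁ ++ xs₂ × map f xs₁ ⊆ ys × map f xs₂ ⊆ zs
  split-⊆-++ f xs       []       zs xs⊆      = [] , xs , refl , [] , xs⊆
  split-⊆-++ f []       (y ∷ ys) zs []⊆      = [] , [] , refl , minimum (y ∷ ys) , minimum zs
  split-⊆-++ f (x ∷ xs) (y ∷ ys) zs (.y ∷ʳ xs⊆) with split-⊆-++ f (x ∷ xs) ys zs xs⊆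
  ... | xs₁ , xs₂ , eq , xs₁⊆ , xs₂⊆ = xs₁ , xs₂ , eq , y ∷ʳ xs₁⊆ , xs₂⊆
  split-⊆-++ f (x ∷ xs) (y ∷ ys) zs (fx≡y ∷ xs⊆) with split-⊆-++ f xs ys zs xs⊆
  ... | xs₁ , xs₂ , eq , xs₁⊆ , xs₂⊆ = x ∷ xs₁ , xs₂ , cong (x ∷_) eq , fx≡y ∷ xs₁⊆ , xs₂⊆

  applyUpTo-cong< : ∀ {f g : ℕ → A} t → (∀ j → j < t → f j ≡ g j) → applyUpTo f t ≡ applyUpTo g t
  applyUpTo-cong< zero    _  = refl
  applyUpTo-cong< (suc t) eq = cong₂ _∷_ (eq 0 (s≤s z≤n)) (applyUpTo-cong< t (λ j j<t → eq (suc j) (s≤s j<t)))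

  applyDownFrom≡applyUpTo : ∀ (f : ℕ → A) t → applyDownFrom f t ≡ applyUpTo (λ j → f (t ∸ suc j)) t
  applyDownFrom≡applyUpTo f zero    = refl
  applyDownFrom≡applyUpTo f (suc t) = cong (f t ∷_) (applyDownFrom≡applyUpTo f t)

concatMap-upTo-cong< : ∀ {A : Set} {f g : ℕ → List A} t → (∀ j → j < t → f j ≡ g j) → concatMap f (upTo t) ≡ concatMap g (upTo t)
concatMap-upTo-cong< {f = f} {g} t eq =
  trans (cong concat (map-upTo f t)) (trans (cong concat (applyUpTo-cong< t eq)) (sym (cong concat (map-upTo g t))))

concatMap-upTo-∷ʳ : ∀ {A : Set} (f : ℕ → List A) t → concatMap f (upTo (suc t)) ≡ concatMap f (upTo t) ++ f t
concatMap-upTo-∷ʳ f t = begin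
  concatMap f (upTo (suc t))          ≡⟨ cong (concatMap f) (sym (upTo-∷ʳ t)) ⟩
  concatMap f (upTo t ++ [ t ])       ≡⟨ concatMap-++ f (upTo t) [ t ] ⟩
  concatMap f (upTo t) ++ (f t ++ []) ≡⟨ cong (concatMap f (upTo t) ++_) (++-identityʳ (f t)) ⟩
  concatMap f (upTo t) ++ f t         ∎
  where open ≡-Reasoning

module _ {A B : Set} where

  ⊆-pair : ∀ (f : A → B) xs {a b} → map f xs ⊆ a ∷ b ∷ [] →
           map f xs ⊆ [ a ] ⊎ (∃[ x ] xs ≡ [ x ] × f x ≡ b) ⊎ (∃[ x ] ∃[ y ] xs ≡ x ∷ y ∷ [] × f x ≡ a × f y ≡ b)
  ⊆-pair f []           _                     = inj₁ (minimum _)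
  ⊆-pair f (x ∷ [])     (fx≡a ∷ _)            = inj₁ (fx≡a ∷ [])
  ⊆-pair f (x ∷ [])     (_ ∷ʳ (fx≡b ∷ _))     = inj₂ (inj₁ (x , refl , fx≡b))
  ⊆-pair f (x ∷ y ∷ []) (fx≡a ∷ (fy≡b ∷ _))   = inj₂ (inj₂ (x , y , refl , fx≡a , fy≡b))
  ⊆-pair f (x ∷ y ∷ _)  (_ ∷ʳ (_ ∷ ()))
  ⊆-pair f (x ∷ y ∷ _)  (_ ∷ʳ (_ ∷ʳ ()))
  ⊆-pair f (x ∷ y ∷ z ∷ _) (_ ∷ (_ ∷ ()))
  ⊆-pair f (x ∷ y ∷ z ∷ _) (_ ∷ (_ ∷ʳ ()))

sorted-↭-unique : ∀ {xs ys : List ℕ} → AllPairs _≤_ xs → AllPairs _≤_ ys → xs ↭ ys → xs ≡ ys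
sorted-↭-unique xs↗ ys↗ xs↭ys =
  ≋⇒≡ (↗↭↗⇒≋ ≤-totalOrder (AllPairs⇒Sorted ≤-totalOrder xs↗) (AllPairs⇒Sorted ≤-totalOrder ys↗) (↭⇒↭ₛ xs↭ys))

2*n≡n+n : ∀ n → 2 * n ≡ n + n
2*n≡n+n n = cong (n +_) (+-identityʳ n)

2*[1+n]≡2*n+2 : ∀ n → 2 * suc n ≡ 2 * n + 2
2*[1+n]≡2*n+2 n = trans (*-suc 2 n) (+-comm 2 (2 * n))

2*[1+n]+1≡2*n+3 : ∀ n → 2 * suc n + 1 ≡ 2 * n + 3
2*[1+n]+1≡2*n+3 n = trans (cong (_+ 1) (2*[1+n]≡2*n+2 n)) (+-assoc (2 * n) 2 1)

2*[1+n]≡2+n+n : ∀ n → 2 * suc n ≡ suc (suc (n + n))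
2*[1+n]≡2+n+n n = trans (*-suc 2 n) (cong (λ m → suc (suc m)) (2*n≡n+n n))

-- Prefix reversals
Entry : Set
Entry = ℕ × Deco

flipRev : Peg → Peg
flipRev w = reverse (map flipE w)

flipD-involutive : ∀ d → flipD (flipD d) ≡ d
flipD-involutive plus  = refl
flipD-involutive minus = refl
flipD-involutive dot   = refl

flipE-involutive : ∀ e → flipE (flipE e) ≡ e
flipE-involutive (v , d) = cong (v ,_) (flipD-involutive d)

flipRev-involutive : ∀ w → flipRev (flipRev w) ≡ w
flipRev-involutive w = begin
  reverse (map flipE (reverse (map flipE w))) ≡⟨ cong reverse (reverse-map flipE (map flipE w)) ⟩
  reverse (reverse (map flipE (map flipE w))) ≡⟨ reverse-involutive _ ⟩
  map flipE (map flipE w)                     ≡⟨ sym (map-∘ w) ⟩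
  map (λ e → flipE (flipE e)) w               ≡⟨ map-cong flipE-involutive w ⟩
  map (λ e → e) w                             ≡⟨ map-id w ⟩
  w                                           ∎
  where open ≡-Reasoning

flipRev-++ : ∀ u w → flipRev (u ++ w) ≡ flipRev w ++ flipRev u
flipRev-++ u w = trans (cong reverse (map-++ flipE u w)) (reverse-++ (map flipE u) (map flipE w))

flipRev-∷ : ∀ e w → flipRev (e ∷ w) ≡ flipRev w ++ [ flipE e ]
flipRev-∷ e w = unfold-reverse (flipE e) (map flipE w)

flipRev-∷ʳ : ∀ w e → flipRev (w ++ [ e ]) ≡ flipE e ∷ flipRev w
flipRev-∷ʳ w e = flipRev-++ w [ e ]

flipRev-middle : ∀ u x w → flipRev (u ++ x ∷ w) ≡ flipRev w ++ flipE x ∷ flipRev u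
flipRev-middle u x w = begin
  flipRev (u ++ x ∷ w)                ≡⟨ flipRev-++ u (x ∷ w) ⟩
  flipRev (x ∷ w) ++ flipRev u        ≡⟨ cong (_++ flipRev u) (flipRev-∷ x w) ⟩
  (flipRev w ++ [ flipE x ]) ++ flipRev u ≡⟨ ++-assoc (flipRev w) _ (flipRev u) ⟩
  flipRev w ++ flipE x ∷ flipRev u    ∎
  where open ≡-Reasoning

length-flipRev : ∀ w → length (flipRev w) ≡ length w
length-flipRev w = trans (length-reverse (map flipE w)) (length-map flipE w)

vals-flipRev : ∀ w → vals (flipRev w) ≡ reverse (vals w)
vals-flipRev w = trans (reverse-map proj₁ (map flipE w)) (cong reverse (sym (map-∘ w)))

length-prefRev : ∀ i w → length (prefRev i w) ≡ length w
length-prefRev i w = begin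
  length (flipRev (take i w) ++ drop i w)        ≡⟨ length-++ (flipRev (take i w)) ⟩
  length (flipRev (take i w)) + length (drop i w) ≡⟨ cong (_+ length (drop i w)) (length-flipRev (take i w)) ⟩
  length (take i w) + length (drop i w)          ≡⟨ sym (length-++ (take i w)) ⟩
  length (take i w ++ drop i w)                  ≡⟨ cong length (take++drop≡id i w) ⟩
  length w                                       ∎
  where open ≡-Reasoning

prefRev-all : ∀ i w → length w ≤ i → prefRev i w ≡ flipRev w
prefRev-all i w w≤i =
  trans (cong₂ (λ u v → flipRev u ++ v) (take-all i w w≤i) (drop-all i w w≤i)) (++-identityʳ (flipRev w))

prefRev-length : ∀ w → prefRev (length w) w ≡ flipRev w
prefRev-length w = prefRev-all (length w) w ≤-refl

prefRev-++ : ∀ i u w → i ≤ length u → prefRev i (u ++ w) ≡ prefRev i u ++ w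
prefRev-++ i u w i≤u = begin
  flipRev (take i (u ++ w)) ++ drop i (u ++ w) ≡⟨ cong₂ (λ x y → flipRev x ++ y) (take-++-≤ i u w i≤u) (drop-++-≤ i u w i≤u) ⟩
  flipRev (take i u) ++ (drop i u ++ w)       ≡⟨ sym (++-assoc (flipRev (take i u)) (drop i u) w) ⟩
  (flipRev (take i u) ++ drop i u) ++ w       ∎
  where open ≡-Reasoning

prefRev-length-++ : ∀ u w → prefRev (length u) (u ++ w) ≡ flipRev u ++ w
prefRev-length-++ u w = trans (prefRev-++ (length u) u w ≤-refl) (cong (_++ w) (prefRev-length u))

prefRev-map : ∀ (f : Entry → Entry) → (∀ e → flipE (f e) ≡ f (flipE e)) →
              ∀ i w → map f (prefRev i w) ≡ prefRev i (map f w)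
prefRev-map f f-flipE i w = begin
  map f (reverse (map flipE (take i w)) ++ drop i w)         ≡⟨ map-++ f _ (drop i w) ⟩
  map f (reverse (map flipE (take i w))) ++ map f (drop i w) ≡⟨ cong₂ _++_ (reverse-map f (map flipE (take i w))) (sym (drop-map i w)) ⟩
  reverse (map f (map flipE (take i w))) ++ drop i (map f w) ≡⟨ cong (λ u → reverse u ++ drop i (map f w)) commute ⟩
  reverse (map flipE (map f (take i w))) ++ drop i (map f w) ≡⟨ cong (λ u → flipRev u ++ drop i (map f w)) (sym (take-map i w)) ⟩
  prefRev i (map f w)                                        ∎
  where
  open ≡-Reasoning
  commute : map f (map flipE (take i w)) ≡ map flipE (map f (take i w))
  commute = trans (sym (map-∘ (take i w))) (trans (map-cong (λ e → sym (f-flipE e)) (take i w)) (map-∘ (take i w)))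

-- Unlike ReachIn, Flips records the word reached and only uses reversals of length at most
-- the word's length, so that a flip sequence can be replayed on an extended word.
data Flips : ℕ → Peg → Peg → Set where
  none : ∀ {w} → Flips 0 w w
  flip : ∀ {k w v} i → i ≤ length w → Flips k (prefRev i w) v → Flips (suc k) w v

Flips-trans : ∀ {a b w v u} → Flips a w v → Flips b v u → Flips (a + b) w u
Flips-trans none             fs′ = fs′
Flips-trans (flip i i≤w fs) fs′ = flip i i≤w (Flips-trans fs fs′)

flipAll : ∀ w → Flips 1 w (flipRev w)
flipAll w = flip (length w) ≤-refl (subst (λ u → Flips 0 u (flipRev w)) (sym (prefRev-length w)) none)

flipPrefix : ∀ u w → Flips 1 (u ++ w) (flipRev u ++ w)
flipPrefix u w = flip (length u) (length-++-≤ˡ u) (subst (λ x → Flips 0 x (flipRev u ++ w)) (sym (prefRev-length-++ u w)) none)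

Flips-length : ∀ {k w v} → Flips k w v → length v ≡ length w
Flips-length none                     = refl
Flips-length {w = w} (flip i _ fs) = trans (Flips-length fs) (length-prefRev i w)

Flips-++ : ∀ {k w v} z → Flips k w v → Flips k (w ++ z) (v ++ z)
Flips-++ z none = none
Flips-++ {w = w} z (flip i i≤w fs) =
  flip i (≤-trans i≤w (length-++-≤ˡ w)) (subst (λ u → Flips _ u _) (sym (prefRev-++ i w z i≤w)) (Flips-++ z fs))

Flips-map : ∀ (f : Entry → Entry) → (∀ e → flipE (f e) ≡ f (flipE e)) →
            ∀ {k w v} → Flips k w v → Flips k (map f w) (map f v)
Flips-map f f-flipE none = none
Flips-map f f-flipE {w = w} (flip i i≤w fs) =
  flip i (subst (i ≤_) (sym (length-map f w)) i≤w)
       (subst (λ u → Flips _ u _) (prefRev-map f f-flipE i w) (Flips-map f f-flipE fs))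

Flips⇒ReachIn : ∀ {k w v} → Flips k w v → IsSortedPeg v → ReachIn k w
Flips⇒ReachIn none            sorted = done sorted
Flips⇒ReachIn (flip i _ fs) sorted = step i (Flips⇒ReachIn fs sorted)

prefRev-inRange : ∀ i w → ∃[ j ] j ≤ length w × prefRev i w ≡ prefRev j w
prefRev-inRange i w with i ≤? length w
... | yes i≤w = i , i≤w , refl
... | no  i≰w = length w , ≤-refl , trans (prefRev-all i w (≰⇒≥ i≰w)) (sym (prefRev-length w))

ReachIn⇒Flips : ∀ {k w} → ReachIn k w → ∃[ k′ ] ∃[ v ] k′ ≤ k × Flips k′ w v × IsSortedPeg v
ReachIn⇒Flips (done sorted) = 0 , _ , z≤n , none , sorted
ReachIn⇒Flips {w = w} (step i r) with ReachIn⇒Flips r | prefRev-inRange i w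
... | k′ , v , k′≤k , fs , sorted | j , j≤w , eq =
  suc k′ , v , s≤s k′≤k , flip j j≤w (subst (λ u → Flips k′ u v) eq fs) , sorted

ReachIn-mono : ∀ {k k′ w} → k ≤ k′ → ReachIn k w → ReachIn k′ w
ReachIn-mono _           (done sorted) = done sorted
ReachIn-mono (s≤s k≤k′) (step i r)    = step i (ReachIn-mono k≤k′ r)

oneTo-suc : ∀ m → oneTo (suc m) ≡ 1 ∷ map suc (oneTo m)
oneTo-suc m = cong (λ u → 1 ∷ map suc u) (sym (map-upTo suc m))

oneTo-∷ʳ : ∀ m → oneTo (suc m) ≡ oneTo m ++ [ suc m ]
oneTo-∷ʳ m = trans (cong (map suc) (sym (upTo-∷ʳ m))) (map-++ suc (upTo m) [ m ])

oneTo-increasing : ∀ m → AllPairs _<_ (oneTo m)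
oneTo-increasing m = subst (AllPairs _<_) (sym (map-upTo suc m)) (AllPairs.applyUpTo⁺₁ suc m (λ i<j _ → s≤s i<j))

oneTo-bounds : ∀ m → All (λ x → 1 ≤ x × x ≤ m) (oneTo m)
oneTo-bounds m = subst (All _) (sym (map-upTo suc m)) (All.applyUpTo⁺₁ suc m (λ i<m → s≤s z≤n , i<m))

shiftE : Entry → Entry
shiftE (v , d) = (suc v , d)

vals-shift : ∀ w → vals (map shiftE w) ≡ map suc (vals w)
vals-shift w = trans (sym (map-∘ w)) (map-∘ w)

decos-shift : ∀ w → decos (map shiftE w) ≡ decos w
decos-shift w = sym (map-∘ w)

unshiftE : Entry → Entry
unshiftE (v , d) = (pred v , d)

Positive : Entry → Set
Positive e = 1 ≤ proj₁ e

All-Positive-shift : ∀ w → All Positive (map shiftE w)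
All-Positive-shift w = All.map⁺ (All.universal (λ _ → s≤s z≤n) w)

map-unshift-shift : ∀ w → map unshiftE (map shiftE w) ≡ w
map-unshift-shift w = trans (sym (map-∘ w)) (map-id w)

map-shift-unshift : ∀ {w} → All Positive w → map shiftE (map unshiftE w) ≡ w
map-shift-unshift []                     = refl
map-shift-unshift {(suc _ , _) ∷ _} (_ ∷ w₊) = cong (_ ∷_) (map-shift-unshift w₊)

flipRev-shift : ∀ w → map shiftE (flipRev w) ≡ flipRev (map shiftE w)
flipRev-shift w = trans (reverse-map shiftE (map flipE w)) (cong reverse (trans (sym (map-∘ w)) (map-∘ w)))

IsSortedPeg-[] : IsSortedPeg []
IsSortedPeg-[] = refl , []

IsSortedPeg-∷ʳ : ∀ {w d} → NotMinus d → IsSortedPeg w → IsSortedPeg (w ++ [ (suc (length w) , d) ])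
IsSortedPeg-∷ʳ {w} {d} d≢- (vals≡ , decos-ok) = vals≡′ , decos-ok′
  where
  vals≡′ : vals (w ++ [ (suc (length w) , d) ]) ≡ oneTo (length (w ++ [ (suc (length w) , d) ]))
  vals≡′ = begin
    vals (w ++ [ (suc (length w) , d) ]) ≡⟨ map-++ proj₁ w _ ⟩
    vals w ++ [ suc (length w) ]         ≡⟨ cong (_++ [ suc (length w) ]) vals≡ ⟩
    oneTo (length w) ++ [ suc (length w) ] ≡⟨ sym (oneTo-∷ʳ (length w)) ⟩
    oneTo (suc (length w))               ≡⟨ cong oneTo (sym (length-∷ʳ w _)) ⟩
    oneTo (length (w ++ [ (suc (length w) , d) ])) ∎
    where open ≡-Reasoning
  decos-ok′ : All NotMinus (decos (w ++ [ (suc (length w) , d) ]))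
  decos-ok′ = subst (All NotMinus) (sym (map-++ proj₂ w _)) (All.++⁺ decos-ok (d≢- ∷ []))

IsSortedPeg-1∷shift : ∀ {w d} → NotMinus d → IsSortedPeg w → IsSortedPeg ((1 , d) ∷ map shiftE w)
IsSortedPeg-1∷shift {w} d≢- (vals≡ , decos-ok) =
  trans (cong (1 ∷_) (trans (vals-shift w) (trans (cong (map suc) vals≡) (cong (λ n → map suc (oneTo n)) (sym (length-map shiftE w))))))
        (sym (oneTo-suc (length (map shiftE w)))) ,
  d≢- ∷ subst (All NotMinus) (sym (decos-shift w)) decos-ok

ReachIn-∷ʳ : ∀ {k w d} → NotMinus d → ReachIn k w → ReachIn k (w ++ [ (suc (length w) , d) ])
ReachIn-∷ʳ {k} {w} {d} d≢- r with ReachIn⇒Flips r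
... | k′ , v , k′≤k , fs , sorted =
  ReachIn-mono k′≤k (Flips⇒ReachIn (Flips-++ [ (suc (length w) , d) ] fs)
    (subst (λ n → IsSortedPeg (v ++ [ (suc n , d) ])) (Flips-length fs) (IsSortedPeg-∷ʳ d≢- sorted)))

IsPeg-resp : ∀ {u w} → vals u ↭ vals w → length u ≡ length w → IsPeg w → IsPeg u
IsPeg-resp {w = w} u↭w |u|≡|w| w-peg = ↭-trans u↭w (subst (λ n → vals w ↭ oneTo n) (sym |u|≡|w|) w-peg)

IsPeg-prefRev : ∀ i w → IsPeg w → IsPeg (prefRev i w)
IsPeg-prefRev i w = IsPeg-resp vals↭ (length-prefRev i w)
  where
  open PermutationReasoning
  vals↭ : vals (prefRev i w) ↭ vals w
  vals↭ = begin
    vals (flipRev (take i w) ++ drop i w)           ≡⟨ map-++ proj₁ (flipRev (take i w)) (drop i w) ⟩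
    vals (flipRev (take i w)) ++ vals (drop i w)    ≡⟨ cong (_++ vals (drop i w)) (vals-flipRev (take i w)) ⟩
    reverse (vals (take i w)) ++ vals (drop i w)    ↭⟨ Perm.++⁺ʳ (vals (drop i w)) (Perm.↭-reverse (vals (take i w))) ⟩
    vals (take i w) ++ vals (drop i w)              ≡⟨ sym (map-++ proj₁ (take i w) (drop i w)) ⟩
    vals (take i w ++ drop i w)                     ≡⟨ cong vals (take++drop≡id i w) ⟩
    vals w                                          ∎

IsPeg-flipRev : ∀ {w} → IsPeg w → IsPeg (flipRev w)
IsPeg-flipRev {w} = subst IsPeg (prefRev-length w) ∘ IsPeg-prefRev (length w) w

rotate↭ : ∀ x u → vals (u ++ [ x ]) ↭ vals (x ∷ u)
rotate↭ x u = subst (_↭ vals (x ∷ u)) (sym (map-++ proj₁ u [ x ])) (↭-sym (Perm.∷↭∷ʳ (proj₁ x) (vals u)))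

IsPeg-rotate : ∀ {x u} → IsPeg (x ∷ u) → IsPeg (u ++ [ x ])
IsPeg-rotate {x} {u} = IsPeg-resp {u ++ [ x ]} {x ∷ u} (rotate↭ x u) (length-∷ʳ u x)

IsPeg-unrotate : ∀ {x u} → IsPeg (u ++ [ x ]) → IsPeg (x ∷ u)
IsPeg-unrotate {x} {u} = IsPeg-resp {x ∷ u} {u ++ [ x ]} (↭-sym (rotate↭ x u)) (sym (length-∷ʳ u x))

IsPeg-bringFront : ∀ {u x w} → IsPeg (u ++ x ∷ w) → IsPeg (x ∷ u ++ w)
IsPeg-bringFront {u} {x} {w} = IsPeg-resp {x ∷ u ++ w} {u ++ x ∷ w} front↭ lengths
  where
  front↭ : vals (x ∷ u ++ w) ↭ vals (u ++ x ∷ w)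
  front↭ = subst₂ _↭_ (cong (proj₁ x ∷_) (sym (map-++ proj₁ u w))) (sym (map-++ proj₁ u (x ∷ w)))
                  (↭-sym (Perm.shift (proj₁ x) (vals u) (vals w)))
  lengths : length (x ∷ u ++ w) ≡ length (u ++ x ∷ w)
  lengths = sym (length-++-sucʳ u x w)

IsPeg-∷ʳ : ∀ {w} d → IsPeg w → IsPeg (w ++ [ (suc (length w) , d) ])
IsPeg-∷ʳ {w} d w-peg = begin
  vals (w ++ [ (suc (length w) , d) ])   ≡⟨ map-++ proj₁ w _ ⟩
  vals w ++ [ suc (length w) ]           ↭⟨ Perm.++⁺ʳ [ suc (length w) ] w-peg ⟩
  oneTo (length w) ++ [ suc (length w) ] ≡⟨ sym (oneTo-∷ʳ (length w)) ⟩
  oneTo (suc (length w))                 ≡⟨ cong oneTo (sym (length-∷ʳ w _)) ⟩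
  oneTo (length (w ++ [ (suc (length w) , d) ])) ∎
  where open PermutationReasoning

IsPeg-1∷shift : ∀ {w} d → IsPeg w → IsPeg ((1 , d) ∷ map shiftE w)
IsPeg-1∷shift {w} d w-peg = begin
  1 ∷ vals (map shiftE w)          ≡⟨ cong (1 ∷_) (vals-shift w) ⟩
  1 ∷ map suc (vals w)             ↭⟨ prep 1 (Perm.map⁺ suc w-peg) ⟩
  1 ∷ map suc (oneTo (length w))   ≡⟨ sym (oneTo-suc (length w)) ⟩
  oneTo (suc (length w))           ≡⟨ cong (λ n → oneTo (suc n)) (sym (length-map shiftE w)) ⟩
  oneTo (suc (length (map shiftE w))) ∎
  where open PermutationReasoning

IsPeg-bounds : ∀ {w} → IsPeg w → All (λ e → 1 ≤ proj₁ e × proj₁ e ≤ length w) w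
IsPeg-bounds w-peg = All.map⁻ (Perm.All-resp-↭ (↭-sym w-peg) (oneTo-bounds _))

IsPeg-below : ∀ {w} → IsPeg w → All (λ e → proj₁ e < suc (length w)) w
IsPeg-below w-peg = All.map (λ (_ , e≤w) → s≤s e≤w) (IsPeg-bounds w-peg)

top∈oneTo : ∀ m → suc m ∈ oneTo (suc m)
top∈oneTo m = subst (suc m ∈_) (sym (oneTo-∷ʳ m)) (∈-++⁺ʳ (oneTo m) (here refl))

IsPeg-max∷⁻ : ∀ {v d w} → IsPeg ((v , d) ∷ w) → All (λ e → proj₁ e < v) w → v ≡ suc (length w) × IsPeg w
IsPeg-max∷⁻ {v} {d} {w} peg below with Perm.∈-resp-↭ (↭-sym peg) (top∈oneTo (length w))
... | there top∈w = ⊥-elim (<⇒≱ (All.lookup (All.map⁺ below) top∈w) (proj₂ (All.head (IsPeg-bounds {(v , d) ∷ w} peg))))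
... | here top≡v  = sym top≡v , Perm.drop-∷ (begin
  suc (length w) ∷ vals w                ≡⟨ cong (_∷ vals w) top≡v ⟩
  v ∷ vals w                             ↭⟨ peg ⟩
  oneTo (suc (length w))                 ≡⟨ oneTo-∷ʳ (length w) ⟩
  oneTo (length w) ++ [ suc (length w) ] ↭⟨ ↭-sym (Perm.∷↭∷ʳ (suc (length w)) (oneTo (length w))) ⟩
  suc (length w) ∷ oneTo (length w)      ∎)
  where open PermutationReasoning

IsPeg-min∷⁻ : ∀ {v d w} → IsPeg ((v , d) ∷ w) → All (λ e → v < proj₁ e) w → v ≡ 1 × IsPeg (map unshiftE w)
IsPeg-min∷⁻ {v} {d} {w} peg above with Perm.∈-resp-↭ (↭-sym peg) (here {x = 1} refl)
... | there 1∈w = ⊥-elim (<⇒≱ (All.lookup (All.map⁺ above) 1∈w) (proj₁ (All.head (IsPeg-bounds {(v , d) ∷ w} peg))))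
... | here 1≡v  = sym 1≡v , subst (λ n → vals (map unshiftE w) ↭ oneTo n) (sym (length-map unshiftE w)) (begin
  vals (map unshiftE w)                 ≡⟨ trans (sym (map-∘ w)) (map-∘ w) ⟩
  map pred (vals w)                     ↭⟨ Perm.map⁺ pred (Perm.drop-∷ (subst₂ (λ x l → x ∷ vals w ↭ l) (sym 1≡v) (oneTo-suc (length w)) peg)) ⟩
  map pred (map suc (oneTo (length w))) ≡⟨ trans (sym (map-∘ (oneTo (length w)))) (map-id (oneTo (length w))) ⟩
  oneTo (length w)                      ∎)
  where open PermutationReasoning

IsPeg-maxMin⁻ : ∀ {u v₁ d₁ v₂ d₂} → IsPeg (u ++ (v₁ , d₁) ∷ (v₂ , d₂) ∷ []) →
                All (λ e → v₂ < proj₁ e × proj₁ e < v₁) u → v₂ < v₁ →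
                v₁ ≡ suc (suc (length u)) × v₂ ≡ 1 × IsPeg (map unshiftE u)
IsPeg-maxMin⁻ {u} {v₁} {d₁} {v₂} {d₂} peg between v₂<v₁
  with IsPeg-max∷⁻ {v₁} {d₁} {u ++ [ (v₂ , d₂) ]} (IsPeg-bringFront peg) (All.++⁺ (All.map proj₂ between) (v₂<v₁ ∷ []))
... | v₁≡ , rest-peg with IsPeg-min∷⁻ {v₂} {d₂} {u} (IsPeg-unrotate rest-peg) (All.map proj₁ between)
... | v₂≡1 , u-peg = trans v₁≡ (cong suc (length-∷ʳ u (v₂ , d₂))) , v₂≡1 , u-peg

-- Pattern embeddings
Pair : Set
Pair = Entry × Entry

SameOrder : Pair → Pair → Set
SameOrder (e , f) (e′ , f′) =
  ((proj₁ e < proj₁ e′) ⇔ (proj₁ f < proj₁ f′)) × ((proj₁ e′ < proj₁ e) ⇔ (proj₁ f′ < proj₁ f))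

SameOrder-sym : ∀ {p q} → SameOrder p q → SameOrder q p
SameOrder-sym (p<q , q<p) = q<p , p<q

Compatible : Pair → Set
Compatible (e , f) = DecoCompat (proj₂ e) (proj₂ f)

DecoCompat-dot : ∀ {d} → DecoCompat d dot → d ≡ dot
DecoCompat-dot {plus}  ()
DecoCompat-dot {minus} ()
DecoCompat-dot {dot}   _ = refl

-- An occurrence of σ in τ, recorded as the list of pairs (pattern entry , matched entry).
record _↪_ (σ τ : Peg) : Set where
  constructor embedding
  field
    pairs      : List Pair
    source     : map proj₁ pairs ≡ σ
    target     : map proj₂ pairs ⊆ τ
    sameOrder  : AllPairs SameOrder pairs
    compatible : All Compatible pairs

↪-⊆ : ∀ {σ s τ} → σ ↪ s → s ⊆ τ → σ ↪ τ
↪-⊆ (embedding Z σ≡ Z⊆s ord comp) s⊆τ = embedding Z σ≡ (⊆-trans Z⊆s s⊆τ) ord comp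

zip-sameOrder : ∀ e f σ s → Pointwise (λ a b → ((proj₁ e < a) ⇔ (proj₁ f < b)) × ((a < proj₁ e) ⇔ (b < proj₁ f)))
                                      (vals σ) (vals s) → All (SameOrder (e , f)) (zip σ s)
zip-sameOrder e f []      []      []           = []
zip-sameOrder e f (_ ∷ σ) (_ ∷ s) (ord ∷ ords) = ord ∷ zip-sameOrder e f σ s ords

zip-pairs : ∀ σ s → OrdIso (vals σ) (vals s) → Pointwise DecoCompat (decos σ) (decos s) →
            map proj₁ (zip σ s) ≡ σ × map proj₂ (zip σ s) ≡ s × AllPairs SameOrder (zip σ s) × All Compatible (zip σ s)
zip-pairs []      []      []            []          = refl , refl , [] , []
zip-pairs (e ∷ σ) (f ∷ s) (ords ∷ iso) (c ∷ compat) with zip-pairs σ s iso compat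
... | σ≡ , s≡ , ord , comp = cong (e ∷_) σ≡ , cong (f ∷_) s≡ , zip-sameOrder e f σ s ords ∷ ord , c ∷ comp

OrdIso⇒↪ : ∀ σ s → OrdIso (vals σ) (vals s) → Pointwise DecoCompat (decos σ) (decos s) → σ ↪ s
OrdIso⇒↪ σ s iso compat with zip-pairs σ s iso compat
... | σ≡ , s≡ , ord , comp = embedding (zip σ s) σ≡ (⊆-reflexive s≡) ord comp

≼⇒↪ : ∀ {σ τ} → σ ≼ τ → σ ↪ τ
≼⇒↪ {σ} (s , s⊆τ , iso , compat) = ↪-⊆ (OrdIso⇒↪ σ s iso compat) s⊆τ

flipPair : Pair → Pair
flipPair (e , f) = (flipE e , flipE f)

flipPairs : List Pair → List Pair
flipPairs Z = map flipPair (reverse Z)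

flipPairs-map : ∀ (π : Pair → Entry) → (∀ p → π (flipPair p) ≡ flipE (π p)) →
                ∀ Z → map π (flipPairs Z) ≡ flipRev (map π Z)
flipPairs-map π π-flip Z = begin
  map π (map flipPair (reverse Z)) ≡⟨ sym (map-∘ (reverse Z)) ⟩
  map (λ p → π (flipPair p)) (reverse Z) ≡⟨ map-cong π-flip (reverse Z) ⟩
  map (λ p → flipE (π p)) (reverse Z)  ≡⟨ reverse-map (λ p → flipE (π p)) Z ⟩
  reverse (map (λ p → flipE (π p)) Z)  ≡⟨ cong reverse (map-∘ Z) ⟩
  flipRev (map π Z)                    ∎
  where open ≡-Reasoning

flipPairs-sameOrder : ∀ {Z} → AllPairs SameOrder Z → AllPairs SameOrder (flipPairs Z)
flipPairs-sameOrder ord = AllPairs.map⁺ (AllPairs-reverse⁺ (λ {p} {q} → SameOrder-sym {p} {q}) ord)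

flipPairs-compatible : ∀ {Z} → All Compatible Z → All Compatible (flipPairs Z)
flipPairs-compatible comp = All.map⁺ (All-reverse⁺ (All.map (λ {p} → flipCompatible p) comp))
  where
  flipCompatible : ∀ p → Compatible p → Compatible (flipPair p)
  flipCompatible ((_ , plus)  , (_ , .plus))  refl = refl
  flipCompatible ((_ , minus) , (_ , .minus)) refl = refl
  flipCompatible ((_ , dot)   , _)            tt   = tt

↪-flipRev : ∀ {σ τ} → σ ↪ τ → flipRev σ ↪ flipRev τ
↪-flipRev {τ = τ} (embedding Z refl Z⊆τ ord comp) =
  embedding (flipPairs Z) (flipPairs-map proj₁ (λ _ → refl) Z)
    (subst (_⊆ flipRev τ) (sym (flipPairs-map proj₂ (λ _ → refl) Z)) (Sub.reverse⁺ (Sub.map⁺ flipE Z⊆τ)))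
    (flipPairs-sameOrder ord) (flipPairs-compatible comp)

-- The pattern entries matched inside the reversed prefix of τ form a prefix of σ.
↪-prefRev : ∀ {σ τ} → σ ↪ τ → ∀ i → ∃[ j ] prefRev j σ ↪ prefRev i τ
↪-prefRev {τ = τ} (embedding Z refl Z⊆τ ord comp) i
  with split-⊆-++ proj₂ Z (take i τ) (drop i τ) (subst (map proj₂ Z ⊆_) (sym (take++drop≡id i τ)) Z⊆τ)
... | Z₁ , Z₂ , refl , Z₁⊆ , Z₂⊆ with AllPairs-++⁻ Z₁ ord
... | ord₁ , ord₂ , across =
  length Z₁ ,
  embedding (flipPairs Z₁ ++ Z₂) source′ target′
    (AllPairs.++⁺ (flipPairs-sameOrder ord₁) ord₂ (All.map⁺ (All-reverse⁺ across)))
    (All.++⁺ (flipPairs-compatible (All.++⁻ˡ Z₁ comp)) (All.++⁻ʳ Z₁ comp))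
  where
  open ≡-Reasoning
  source′ : map proj₁ (flipPairs Z₁ ++ Z₂) ≡ prefRev (length Z₁) (map proj₁ (Z₁ ++ Z₂))
  source′ = begin
    map proj₁ (flipPairs Z₁ ++ Z₂)             ≡⟨ map-++ proj₁ (flipPairs Z₁) Z₂ ⟩
    map proj₁ (flipPairs Z₁) ++ map proj₁ Z₂   ≡⟨ cong (_++ map proj₁ Z₂) (flipPairs-map proj₁ (λ _ → refl) Z₁) ⟩
    flipRev (map proj₁ Z₁) ++ map proj₁ Z₂     ≡⟨ sym (prefRev-length-++ (map proj₁ Z₁) (map proj₁ Z₂)) ⟩
    prefRev (length (map proj₁ Z₁)) (map proj₁ Z₁ ++ map proj₁ Z₂) ≡⟨ cong₂ prefRev (length-map proj₁ Z₁) (sym (map-++ proj₁ Z₁ Z₂)) ⟩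
    prefRev (length Z₁) (map proj₁ (Z₁ ++ Z₂)) ∎
  target′ : map proj₂ (flipPairs Z₁ ++ Z₂) ⊆ prefRev i τ
  target′ = subst (_⊆ prefRev i τ)
    (sym (trans (map-++ proj₂ (flipPairs Z₁) Z₂) (cong (_++ map proj₂ Z₂) (flipPairs-map proj₂ (λ _ → refl) Z₁))))
    (Sub.++⁺ (Sub.reverse⁺ (Sub.map⁺ flipE Z₁⊆)) Z₂⊆)

↪-NotMinus : ∀ {σ τ} → σ ↪ τ → All (λ e → NotMinus (proj₂ e)) τ → All NotMinus (decos σ)
↪-NotMinus (embedding Z refl Z⊆τ _ comp) τ-ok =
  All.map⁺ (All.map⁺ (All.zipWith (λ {p} → notMinus {p}) (comp , All.map⁻ (Sub.All-resp-⊆ Z⊆τ τ-ok))))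
  where
  notMinus : ∀ {p} → Compatible p × NotMinus (proj₂ (proj₂ p)) → NotMinus (proj₂ (proj₁ p))
  notMinus {(_ , plus)  , _} _               = λ ()
  notMinus {(_ , dot)   , _} _               = λ ()
  notMinus {(_ , minus) , _} (refl , occ≢-) = λ _ → occ≢- refl

↪-sorted : ∀ {σ τ} → σ ↪ τ → IsPeg σ → IsSortedPeg τ → IsSortedPeg σ
↪-sorted {τ = τ} (embedding Z refl Z⊆τ ord comp) σ-peg (τ-vals , τ-decos) = σ-vals , σ-decos
  where
  τ↗ : AllPairs (λ e f → proj₁ e < proj₁ f) τ
  τ↗ = AllPairs.map⁻ (subst (AllPairs _<_) (sym τ-vals) (oneTo-increasing (length τ)))
  Z↗ : AllPairs (λ p q → proj₁ (proj₁ p) < proj₁ (proj₁ q)) Z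
  Z↗ = AllPairs.zipWith (λ (same , occ<) → Equivalence.from (proj₁ same) occ<)
                        (ord , AllPairs.map⁻ (AllPairs-resp-⊆ Z⊆τ τ↗))
  σ-vals : vals (map proj₁ Z) ≡ oneTo (length (map proj₁ Z))
  σ-vals = sorted-↭-unique (AllPairs.map⁺ (AllPairs.map⁺ (AllPairs.map <⇒≤ Z↗)))
                           (AllPairs.map <⇒≤ (oneTo-increasing _)) σ-peg
  σ-decos : All NotMinus (decos (map proj₁ Z))
  σ-decos = ↪-NotMinus (embedding Z refl Z⊆τ ord comp) (All.map⁻ τ-decos)

ReachIn-↪ : ∀ {k σ τ} → σ ↪ τ → IsPeg σ → ReachIn k τ → ReachIn k σ
ReachIn-↪ σ↪τ σ-peg (done sorted) = done (↪-sorted σ↪τ σ-peg sorted)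
ReachIn-↪ {σ = σ} σ↪τ σ-peg (step i r) with ↪-prefRev σ↪τ i
... | j , σ′↪τ′ = step j (ReachIn-↪ σ′↪τ′ (IsPeg-prefRev j σ σ-peg) r)

below-max : ∀ {τ Z} (top : Pair) → All (λ f → proj₁ f < proj₁ (proj₂ top)) τ → map proj₂ Z ⊆ τ →
            All (SameOrder top) Z → All (λ x → proj₁ x < proj₁ (proj₁ top)) (map proj₁ Z)
below-max _ τ<top Z⊆ top~ =
  All.map⁺ (All.zipWith (λ (same , f<top) → Equivalence.from (proj₂ same) f<top) (top~ , All.map⁻ (Sub.All-resp-⊆ Z⊆ τ<top)))

between-extremes : ∀ {τ n v₁ d₁ e₁ v₂ d₂ e₂ Z} → All (λ f → 1 < proj₁ f × proj₁ f < n) τ → map proj₂ Z ⊆ τ →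
                   All (λ p → All (SameOrder p) (((v₁ , d₁) , (n , e₁)) ∷ ((v₂ , d₂) , (1 , e₂)) ∷ [])) Z →
                   All (λ x → v₂ < proj₁ x × proj₁ x < v₁) (map proj₁ Z)
between-extremes τ-inside Z⊆ extremes~ =
  All.map⁺ (All.zipWith (λ { ((to-max ∷ to-min ∷ []) , (1<f , f<n)) →
                                 Equivalence.from (proj₂ to-min) 1<f , Equivalence.from (proj₁ to-max) f<n })
                        (extremes~ , All.map⁻ (Sub.All-resp-⊆ Z⊆ τ-inside)))

pred-<-⇔ : ∀ {a b} → 1 ≤ a → 1 ≤ b → (a < b) ⇔ (pred a < pred b)
pred-<-⇔ {suc a} {suc b} _ _ = mk⇔ ≤-pred s≤s

↪-unshiftTarget : ∀ {σ τ} → σ ↪ map shiftE τ → σ ↪ τ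
↪-unshiftTarget {τ = τ} (embedding Z refl Z⊆τ ord comp) =
  embedding (map unshift₂ Z) (sym (map-∘ Z)) target′ ord′ (All.map⁺ comp)
  where
  unshift₂ : Pair → Pair
  unshift₂ (e , f) = (e , unshiftE f)
  target′ : map proj₂ (map unshift₂ Z) ⊆ τ
  target′ = subst₂ _⊆_ (trans (sym (map-∘ Z)) (map-∘ Z)) (map-unshift-shift τ) (Sub.map⁺ unshiftE Z⊆τ)
  ord′ : AllPairs SameOrder (map unshift₂ Z)
  ord′ = AllPairs-map-restricted unshift₂
    (λ f₊ f′₊ (lt , gt) → pred-<-⇔ f₊ f′₊ ⇔-∘ lt , pred-<-⇔ f′₊ f₊ ⇔-∘ gt)
    (All.map⁻ (Sub.All-resp-⊆ Z⊆τ (All-Positive-shift τ))) ord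

↪-unshift : ∀ {σ τ} → σ ↪ map shiftE τ → All Positive σ → map unshiftE σ ↪ τ
↪-unshift {τ = τ} (embedding Z refl Z⊆τ ord comp) σ₊ =
  embedding (map unshift Z) (trans (sym (map-∘ Z)) (map-∘ Z)) target′ ord′ (All.map⁺ comp)
  where
  unshift : Pair → Pair
  unshift (e , f) = (unshiftE e , unshiftE f)
  target′ : map proj₂ (map unshift Z) ⊆ τ
  target′ = subst₂ _⊆_ (trans (sym (map-∘ Z)) (map-∘ Z)) (map-unshift-shift τ) (Sub.map⁺ unshiftE Z⊆τ)
  ord′ : AllPairs SameOrder (map unshift Z)
  ord′ = AllPairs-map-restricted unshift
    (λ (e₊ , f₊) (e′₊ , f′₊) (lt , gt) →
       pred-<-⇔ f₊ f′₊ ⇔-∘ (lt ⇔-∘ ⇔-sym (pred-<-⇔ e₊ e′₊)) ,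
       pred-<-⇔ f′₊ f₊ ⇔-∘ (gt ⇔-∘ ⇔-sym (pred-<-⇔ e′₊ e₊)))
    (All.zip (All.map⁻ σ₊ , All.map⁻ (Sub.All-resp-⊆ Z⊆τ (All-Positive-shift τ)))) ord

-- Breakpoints
incOK? : ∀ d → Dec (IncOK d)
incOK? plus  = yes (λ ())
incOK? minus = no (λ ok → ok refl)
incOK? dot   = yes (λ ())

decOK? : ∀ d → Dec (DecOK d)
decOK? plus  = no (λ ok → ok refl)
decOK? minus = yes (λ ())
decOK? dot   = yes (λ ())

stripPair? : ∀ x y → Dec (StripPair x y)
stripPair? (a , d) (b , e) =
  (b ≟ suc a ×-dec (incOK? d ×-dec incOK? e)) ⊎-dec (a ≟ suc b ×-dec (decOK? d ×-dec decOK? e))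

breakpoint : Entry → Entry → ℕ
breakpoint x y with stripPair? x y
... | yes _ = 0
... | no  _ = 1

breakpoint≤1 : ∀ x y → breakpoint x y ≤ 1
breakpoint≤1 x y with stripPair? x y
... | yes _ = z≤n
... | no  _ = s≤s z≤n

breakpoint-strip : ∀ {x y} → StripPair x y → breakpoint x y ≡ 0
breakpoint-strip {x} {y} s with stripPair? x y
... | yes _ = refl
... | no ¬s = ⊥-elim (¬s s)

breakpoint-nonStrip : ∀ {x y} → ¬ StripPair x y → breakpoint x y ≡ 1
breakpoint-nonStrip {x} {y} ¬s with stripPair? x y
... | yes s = ⊥-elim (¬s s)
... | no  _ = refl

breakpoint≡1⇒nonStrip : ∀ {x y} → breakpoint x y ≡ 1 → ¬ StripPair x y
breakpoint≡1⇒nonStrip eq s = 0≢1+n (trans (sym (breakpoint-strip s)) eq)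

breakpoint-far : ∀ {a b d e} → b ≢ suc a → a ≢ suc b → breakpoint (a , d) (b , e) ≡ 1
breakpoint-far b≢a+1 a≢b+1 = breakpoint-nonStrip λ
  { (inj₁ (b≡a+1 , _)) → b≢a+1 b≡a+1
  ; (inj₂ (a≡b+1 , _)) → a≢b+1 a≡b+1 }

StripPair-flip : ∀ {x y} → StripPair x y → StripPair (flipE y) (flipE x)
StripPair-flip {_ , d} {_ , e} (inj₁ (b≡a+1 , d-ok , e-ok)) = inj₂ (b≡a+1 , flipInc e e-ok , flipInc d d-ok)
  where
  flipInc : ∀ d → IncOK d → DecOK (flipD d)
  flipInc plus  _  = λ ()
  flipInc minus ok = ⊥-elim (ok refl)
  flipInc dot   _  = λ ()
StripPair-flip {_ , d} {_ , e} (inj₂ (a≡b+1 , d-ok , e-ok)) = inj₁ (a≡b+1 , flipDec e e-ok , flipDec d d-ok)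
  where
  flipDec : ∀ d → DecOK d → IncOK (flipD d)
  flipDec plus  ok = ⊥-elim (ok refl)
  flipDec minus _  = λ ()
  flipDec dot   _  = λ ()

breakpoint-flip : ∀ x y → breakpoint (flipE y) (flipE x) ≡ breakpoint x y
breakpoint-flip x y with stripPair? x y
... | yes s = breakpoint-strip (StripPair-flip s)
... | no ¬s = breakpoint-nonStrip λ s → ¬s (subst₂ StripPair (flipE-involutive x) (flipE-involutive y) (StripPair-flip s))

breakpoint-shift : ∀ x y → breakpoint (shiftE x) (shiftE y) ≡ breakpoint x y
breakpoint-shift x y with stripPair? x y
... | yes (inj₁ (eq , ok)) = breakpoint-strip (inj₁ (cong suc eq , ok))
... | yes (inj₂ (eq , ok)) = breakpoint-strip (inj₂ (cong suc eq , ok))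
... | no ¬s = breakpoint-nonStrip λ
  { (inj₁ (eq , ok)) → ¬s (inj₁ (suc-injective eq , ok))
  ; (inj₂ (eq , ok)) → ¬s (inj₂ (suc-injective eq , ok)) }

breakpointsFrom : Entry → Peg → ℕ
breakpointsFrom x []      = 0
breakpointsFrom x (y ∷ w) = breakpoint x y + breakpointsFrom y w

breakpoints : Peg → ℕ
breakpoints []      = 0
breakpoints (x ∷ w) = breakpointsFrom x w

breakpointsFrom-split : ∀ a u x w → breakpointsFrom a (u ++ x ∷ w) ≡ breakpointsFrom a (u ++ [ x ]) + breakpointsFrom x w
breakpointsFrom-split a []      x w = cong (_+ breakpointsFrom x w) (sym (+-identityʳ (breakpoint a x)))
breakpointsFrom-split a (y ∷ u) x w =
  trans (cong (breakpoint a y +_) (breakpointsFrom-split y u x w)) (sym (+-assoc (breakpoint a y) _ _))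

breakpoints-split : ∀ u x w → breakpoints (u ++ x ∷ w) ≡ breakpoints (u ++ [ x ]) + breakpointsFrom x w
breakpoints-split []      x w = refl
breakpoints-split (a ∷ u) x w = breakpointsFrom-split a u x w

breakpoints-flipRev : ∀ w → breakpoints (flipRev w) ≡ breakpoints w
breakpoints-flipRev []      = refl
breakpoints-flipRev (x ∷ w) = trans (cong breakpoints (flipRev-∷ x w)) (reversed x w)
  where
  reversed : ∀ x w → breakpoints (flipRev w ++ [ flipE x ]) ≡ breakpointsFrom x w
  reversed x []      = refl
  reversed x (y ∷ w) = begin
    breakpoints (flipRev (y ∷ w) ++ [ flipE x ])                ≡⟨ cong (λ u → breakpoints (u ++ [ flipE x ])) (flipRev-∷ y w) ⟩
    breakpoints ((flipRev w ++ [ flipE y ]) ++ [ flipE x ])     ≡⟨ cong breakpoints (++-assoc (flipRev w) [ flipE y ] [ flipE x ]) ⟩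
    breakpoints (flipRev w ++ flipE y ∷ [ flipE x ])            ≡⟨ breakpoints-split (flipRev w) (flipE y) [ flipE x ] ⟩
    breakpoints (flipRev w ++ [ flipE y ]) + (breakpoint (flipE y) (flipE x) + 0)
                                                                ≡⟨ cong₂ _+_ (reversed y w) (trans (+-identityʳ _) (breakpoint-flip x y)) ⟩
    breakpointsFrom y w + breakpoint x y                        ≡⟨ +-comm (breakpointsFrom y w) _ ⟩
    breakpointsFrom x (y ∷ w)                                   ∎
    where open ≡-Reasoning

breakpoints-shift : ∀ w → breakpoints (map shiftE w) ≡ breakpoints w
breakpoints-shift []      = refl
breakpoints-shift (x ∷ w) = shifted x w
  where
  shifted : ∀ x w → breakpointsFrom (shiftE x) (map shiftE w) ≡ breakpointsFrom x w
  shifted x []      = refl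
  shifted x (y ∷ w) = cong₂ _+_ (breakpoint-shift x y) (shifted y w)

breakpointsFrom-≤-head : ∀ x w → breakpointsFrom x w ≤ suc (breakpoints w)
breakpointsFrom-≤-head x []      = z≤n
breakpointsFrom-≤-head x (y ∷ w) = +-monoˡ-≤ (breakpointsFrom y w) (breakpoint≤1 x y)

breakpointsFrom-≥-head : ∀ x w → breakpoints w ≤ breakpointsFrom x w
breakpointsFrom-≥-head x []      = z≤n
breakpointsFrom-≥-head x (y ∷ w) = m≤n+m (breakpointsFrom y w) (breakpoint x y)

breakpoints-++-≤ : ∀ u w → breakpoints (u ++ w) ≤ suc (breakpoints u + breakpoints w)
breakpoints-++-≤ []      w = n≤1+n (breakpoints w)
breakpoints-++-≤ (x ∷ u) w = from x u
  where
  from : ∀ x u → breakpointsFrom x (u ++ w) ≤ suc (breakpointsFrom x u + breakpoints w)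
  from x []      = breakpointsFrom-≤-head x w
  from x (y ∷ u) = ≤-trans (+-monoʳ-≤ (breakpoint x y) (from y u))
                           (≤-reflexive (trans (+-suc (breakpoint x y) _) (cong suc (sym (+-assoc (breakpoint x y) _ _)))))

breakpoints-++-≥ : ∀ u w → breakpoints u + breakpoints w ≤ breakpoints (u ++ w)
breakpoints-++-≥ []      w = ≤-refl
breakpoints-++-≥ (x ∷ u) w = from x u
  where
  from : ∀ x u → breakpointsFrom x u + breakpoints w ≤ breakpointsFrom x (u ++ w)
  from x []      = breakpointsFrom-≥-head x w
  from x (y ∷ u) = ≤-trans (≤-reflexive (+-assoc (breakpoint x y) _ _)) (+-monoʳ-≤ (breakpoint x y) (from y u))

-- A prefix reversal only changes the adjacency at the cut.
breakpoints-prefRev : ∀ i w → breakpoints w ≤ suc (breakpoints (prefRev i w))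
breakpoints-prefRev i w = begin
  breakpoints w                                             ≡⟨ cong breakpoints (sym (take++drop≡id i w)) ⟩
  breakpoints (take i w ++ drop i w)                        ≤⟨ breakpoints-++-≤ (take i w) (drop i w) ⟩
  suc (breakpoints (take i w) + breakpoints (drop i w))     ≡⟨ cong (λ b → suc (b + breakpoints (drop i w))) (sym (breakpoints-flipRev (take i w))) ⟩
  suc (breakpoints (flipRev (take i w)) + breakpoints (drop i w)) ≤⟨ s≤s (breakpoints-++-≥ (flipRev (take i w)) (drop i w)) ⟩
  suc (breakpoints (prefRev i w))                           ∎
  where open ≤-Reasoning

strips⇒breakpoints≡0 : ∀ {w} → Linked StripPair w → breakpoints w ≡ 0
strips⇒breakpoints≡0 []       = refl
strips⇒breakpoints≡0 [-]      = refl
strips⇒breakpoints≡0 (s ∷ ss) = cong₂ _+_ (breakpoint-strip s) (strips⇒breakpoints≡0 ss)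

sorted⇒strips : ∀ {w} → IsSortedPeg w → Linked StripPair w
sorted⇒strips {w} (vals≡ , decos-ok) = combine (Linked.map⁻ consecutive) (All.map⁻ decos-ok)
  where
  consecutive : Linked (λ a b → b ≡ suc a) (vals w)
  consecutive = subst (Linked _) (sym (trans vals≡ (map-upTo suc (length w))))
                      (Linked.applyUpTo⁺₂ suc (length w) (λ _ → refl))
  combine : ∀ {u} → Linked (λ e f → proj₁ f ≡ suc (proj₁ e)) u → All (λ e → NotMinus (proj₂ e)) u → Linked StripPair u
  combine []       _                     = []
  combine [-]      _                     = [-]
  combine (eq ∷ l) (d-ok ∷ ds@(e-ok ∷ _)) = inj₁ (eq , d-ok , e-ok) ∷ combine l ds

breakpointsFrom-≤-length : ∀ x w → breakpointsFrom x w ≤ length w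
breakpointsFrom-≤-length x []      = z≤n
breakpointsFrom-≤-length x (y ∷ w) = +-mono-≤ (breakpoint≤1 x y) (breakpointsFrom-≤-length y w)

breakpoints≡pred-length⇒CleanCompact : ∀ w → breakpoints w ≡ pred (length w) → CleanCompact w
breakpoints≡pred-length⇒CleanCompact []          _  = []
breakpoints≡pred-length⇒CleanCompact (x ∷ [])    _  = [-]
breakpoints≡pred-length⇒CleanCompact (x ∷ y ∷ w) eq =
  breakpoint≡1⇒nonStrip first≡1 ∷ breakpoints≡pred-length⇒CleanCompact (y ∷ w) rest≡
  where
  first≡1 : breakpoint x y ≡ 1
  first≡1 = ≤-antisym (breakpoint≤1 x y)
    (+-cancelʳ-≤ (length w) 1 (breakpoint x y)
      (≤-trans (≤-reflexive (sym eq)) (+-monoʳ-≤ (breakpoint x y) (breakpointsFrom-≤-length y w))))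
  rest≡ : breakpointsFrom y w ≡ length w
  rest≡ = suc-injective (trans (cong (_+ breakpointsFrom y w) (sym first≡1)) eq)

-- The sentinel (n+1)^+ keeps unsorted words such as n^- ⋯ 1^- from having no breakpoint.
extBreakpoints : Peg → ℕ
extBreakpoints w = breakpoints (w ++ [ (suc (length w) , plus) ])

extBreakpoints-prefRev : ∀ i w → extBreakpoints w ≤ suc (extBreakpoints (prefRev i w))
extBreakpoints-prefRev i w with prefRev-inRange i w
... | j , j≤w , eq = subst (λ b → extBreakpoints w ≤ suc b) (sym reversed) (breakpoints-prefRev j (w ++ [ sentinel ]))
  where
  sentinel : Entry
  sentinel = (suc (length w) , plus)
  reversed : extBreakpoints (prefRev i w) ≡ breakpoints (prefRev j (w ++ [ sentinel ]))
  reversed = begin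
    breakpoints (prefRev i w ++ [ (suc (length (prefRev i w)) , plus) ])
                                                ≡⟨ cong (λ n → breakpoints (prefRev i w ++ [ (suc n , plus) ])) (length-prefRev i w) ⟩
    breakpoints (prefRev i w ++ [ sentinel ])                            ≡⟨ cong (λ u → breakpoints (u ++ [ sentinel ])) eq ⟩
    breakpoints (prefRev j w ++ [ sentinel ])                            ≡⟨ cong breakpoints (sym (prefRev-++ j w [ sentinel ] j≤w)) ⟩
    breakpoints (prefRev j (w ++ [ sentinel ]))                          ∎
    where open ≡-Reasoning

extBreakpoints-sorted : ∀ {w} → IsSortedPeg w → extBreakpoints w ≡ 0
extBreakpoints-sorted sorted = strips⇒breakpoints≡0 (sorted⇒strips (IsSortedPeg-∷ʳ (λ ()) sorted))

ReachIn⇒extBreakpoints≤ : ∀ {k w} → ReachIn k w → extBreakpoints w ≤ k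
ReachIn⇒extBreakpoints≤ (done sorted)       = subst (_≤ _) (sym (extBreakpoints-sorted sorted)) z≤n
ReachIn⇒extBreakpoints≤ {w = w} (step i r) = ≤-trans (extBreakpoints-prefRev i w) (s≤s (ReachIn⇒extBreakpoints≤ r))

extBreakpoints-lastBelow : ∀ {w u a d} → w ≡ u ++ [ (a , d) ] → a < length w → extBreakpoints w ≡ suc (breakpoints w)
extBreakpoints-lastBelow {w} {u} {a} {d} w≡ a<w = begin
  breakpoints (w ++ [ sentinel ])                           ≡⟨ cong (λ v → breakpoints (v ++ [ sentinel ])) w≡ ⟩
  breakpoints ((u ++ [ (a , d) ]) ++ [ sentinel ])          ≡⟨ cong breakpoints (++-assoc u [ (a , d) ] [ sentinel ]) ⟩
  breakpoints (u ++ (a , d) ∷ [ sentinel ])                 ≡⟨ breakpoints-split u (a , d) [ sentinel ] ⟩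
  breakpoints (u ++ [ (a , d) ]) + (breakpoint (a , d) sentinel + 0) ≡⟨ cong₂ _+_ (cong breakpoints (sym w≡)) (trans (+-identityʳ _) last-break) ⟩
  breakpoints w + 1                                         ≡⟨ +-comm (breakpoints w) 1 ⟩
  suc (breakpoints w)                                       ∎
  where
  open ≡-Reasoning
  sentinel : Entry
  sentinel = (suc (length w) , plus)
  last-break : breakpoint (a , d) sentinel ≡ 1
  last-break = breakpoint-far (λ eq → <⇒≢ a<w (sym (suc-injective eq))) (<⇒≢ (m<n⇒m<1+n (m<n⇒m<1+n a<w)))

-- The chain Θ
extendΘ : Peg → Peg
extendΘ w = (suc (length w) , dot) ∷ flipRev w

extendΘ≡flipRev : ∀ w → extendΘ w ≡ flipRev (w ++ [ (suc (length w) , dot) ])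
extendΘ≡flipRev w = sym (flipRev-∷ʳ w _)

IsPeg-extendΘ : ∀ {w} → IsPeg w → IsPeg (extendΘ w)
IsPeg-extendΘ {w} w-peg = subst IsPeg (sym (extendΘ≡flipRev w)) (IsPeg-flipRev (IsPeg-∷ʳ dot w-peg))

ReachIn-extendΘ : ∀ {k w} → ReachIn k w → ReachIn (suc k) (extendΘ w)
ReachIn-extendΘ {k} {w} r = step (length (extendΘ w)) (subst (ReachIn k) (sym unflipped) (ReachIn-∷ʳ (λ ()) r))
  where
  unflipped : prefRev (length (extendΘ w)) (extendΘ w) ≡ w ++ [ (suc (length w) , dot) ]
  unflipped = trans (prefRev-length (extendΘ w)) (trans (cong flipRev (extendΘ≡flipRev w)) (flipRev-involutive _))

ReachIn-max∷ : ∀ {k w} → ReachIn k (flipRev w) → ReachIn (suc k) ((suc (length w) , dot) ∷ w)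
ReachIn-max∷ {k} {w} r = subst (ReachIn (suc k)) extended (ReachIn-extendΘ r)
  where
  extended : extendΘ (flipRev w) ≡ (suc (length w) , dot) ∷ w
  extended = cong₂ (λ n u → (suc n , dot) ∷ u) (length-flipRev w) (flipRev-involutive w)

-- The hypothesis a < length w keeps the last entry (a , d) from forming a strip with its new
-- neighbour.
breakpoints-extendΘ : ∀ {w u a d} → w ≡ u ++ [ (a , d) ] → a < length w → breakpoints (extendΘ w) ≡ suc (breakpoints w)
breakpoints-extendΘ {w} {u} {a} {d} w≡ a<w = begin
  breakpointsFrom top (flipRev w)                                      ≡⟨ cong (breakpointsFrom top) flipped ⟩
  breakpoint top (a , flipD d) + breakpoints ((a , flipD d) ∷ flipRev u) ≡⟨ cong₂ _+_ top-break (cong breakpoints (sym flipped)) ⟩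
  1 + breakpoints (flipRev w)                                          ≡⟨ cong suc (breakpoints-flipRev w) ⟩
  suc (breakpoints w)                                                  ∎
  where
  open ≡-Reasoning
  top : Entry
  top = (suc (length w) , dot)
  flipped : flipRev w ≡ (a , flipD d) ∷ flipRev u
  flipped = trans (cong flipRev w≡) (flipRev-∷ʳ u _)
  top-break : breakpoint top (a , flipD d) ≡ 1
  top-break = breakpoint-far (<⇒≢ (m<n⇒m<1+n (m<n⇒m<1+n a<w))) (λ eq → <⇒≢ a<w (sym (suc-injective eq)))

-- Θ n is Θo n for odd n and Θe n for even n ≥ 2 (Θo≡Θ, Θe≡Θ).
Θ : ℕ → Peg
Θ zero          = []
Θ (suc zero)    = (1 , minus) ∷ []
Θ (suc (suc n)) = extendΘ (Θ (suc n))

length-Θ : ∀ n → length (Θ n) ≡ n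
length-Θ zero          = refl
length-Θ (suc zero)    = refl
length-Θ (suc (suc n)) = cong suc (trans (length-flipRev (Θ (suc n))) (length-Θ (suc n)))

IsPeg-Θ : ∀ n → IsPeg (Θ n)
IsPeg-Θ zero          = ↭-refl
IsPeg-Θ (suc zero)    = ↭-refl
IsPeg-Θ (suc (suc n)) = IsPeg-extendΘ (IsPeg-Θ (suc n))

ReachIn-Θ : ∀ n → ReachIn n (Θ n)
ReachIn-Θ zero          = done IsSortedPeg-[]
ReachIn-Θ (suc zero)    = step 1 (done (refl , (λ ()) ∷ []))
ReachIn-Θ (suc (suc n)) = ReachIn-extendΘ (ReachIn-Θ (suc n))

ReachIn-flipRev-Θ : ∀ m → ReachIn m (flipRev (Θ (suc m)))
ReachIn-flipRev-Θ zero    = done (refl , (λ ()) ∷ [])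
ReachIn-flipRev-Θ (suc m) =
  subst (ReachIn (suc m)) (sym (trans (cong flipRev (extendΘ≡flipRev (Θ (suc m)))) (flipRev-involutive _)))
        (ReachIn-∷ʳ (λ ()) (ReachIn-Θ (suc m)))

-- A pattern avoiding the top entry of Θ(m+2) lies in flipRev Θ(m+1); one using it starts with
-- its maximum, and a full reversal moves that maximum out of the way.
Θ-patterns : ∀ n σ → IsPeg σ → length σ < n → σ ↪ Θ n → ReachIn (n ∸ 2) σ
Θ-patterns (suc zero) [] _ _ _ = done IsSortedPeg-[]
Θ-patterns (suc zero) (_ ∷ _) _ (s≤s ()) _
Θ-patterns (suc (suc m)) _ _ _ (embedding [] refl _ _ _) = done IsSortedPeg-[]
Θ-patterns (suc (suc m)) σ σ-peg _ (embedding Z@(_ ∷ _) σ≡ (_ ∷ʳ Z⊆) ord comp) =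
  ReachIn-↪ (embedding Z σ≡ Z⊆ ord comp) σ-peg (ReachIn-flipRev-Θ m)
Θ-patterns (suc (suc m)) _ _ _ (embedding (((_ , plus)  , _) ∷ _) _ (refl ∷ _) _ (() ∷ _))
Θ-patterns (suc (suc m)) _ _ _ (embedding (((_ , minus) , _) ∷ _) _ (refl ∷ _) _ (() ∷ _))
Θ-patterns (suc (suc zero)) _ σ-peg _ (embedding (((v , dot) , _) ∷ []) refl (refl ∷ _) _ _)
  with IsPeg-max∷⁻ {v} {dot} {[]} σ-peg []
... | refl , _ = done (refl , (λ ()) ∷ [])
Θ-patterns (suc (suc zero)) _ _ (s≤s (s≤s ())) (embedding (((_ , dot) , _) ∷ _ ∷ _) refl (refl ∷ _) _ _)
Θ-patterns (suc (suc (suc m))) _ σ-peg σ<n (embedding (((v , dot) , _) ∷ Z) refl (refl ∷ Z⊆) (top~ ∷ ord) (_ ∷ comp)) =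
  subst (λ x → ReachIn (suc m) ((x , dot) ∷ σ′)) (sym (proj₁ maximal))
        (ReachIn-max∷ (Θ-patterns (suc (suc m)) (flipRev σ′) (IsPeg-flipRev (proj₂ maximal)) shorter flipped))
  where
  σ′ : Peg
  σ′ = map proj₁ Z
  τ : Peg
  τ = Θ (suc (suc m))
  below : All (λ e → proj₁ e < v) σ′
  below = below-max ((v , dot) , (suc (length τ) , dot))
            (subst (λ n → All (λ e → proj₁ e < suc n) (flipRev τ)) (length-flipRev τ)
                   (IsPeg-below {flipRev τ} (IsPeg-flipRev (IsPeg-Θ (suc (suc m)))))) Z⊆ top~
  maximal : v ≡ suc (length σ′) × IsPeg σ′
  maximal = IsPeg-max∷⁻ {v} {dot} {σ′} σ-peg below
  shorter : length (flipRev σ′) < suc (suc m)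
  shorter = subst (_< suc (suc m)) (sym (length-flipRev σ′)) (≤-pred σ<n)
  flipped : flipRev σ′ ↪ τ
  flipped = subst (flipRev σ′ ↪_) (flipRev-involutive τ) (↪-flipRev (embedding Z refl Z⊆ ord comp))

Θ-last : ∀ n → ∃[ u ] ∃[ d ] Θ (suc (suc n)) ≡ u ++ [ (suc n , d) ]
Θ-last zero    = (2 , dot) ∷ [] , plus , refl
Θ-last (suc n) =
  (suc (length (Θ (suc (suc n)))) , dot) ∷ flipRev (flipRev (Θ (suc n))) , dot ,
  cong ((suc (length (Θ (suc (suc n)))) , dot) ∷_) (trans (flipRev-∷ (suc (length (Θ (suc n))) , dot) (flipRev (Θ (suc n))))
                     (cong (λ m → flipRev (flipRev (Θ (suc n))) ++ [ (suc m , dot) ]) (length-Θ (suc n))))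

Θ-last-below : ∀ n → suc n < length (Θ (suc (suc n)))
Θ-last-below n = subst (suc n <_) (sym (length-Θ (suc (suc n)))) ≤-refl

breakpoints-Θ : ∀ n → breakpoints (Θ (suc n)) ≡ n
breakpoints-Θ zero          = refl
breakpoints-Θ (suc zero)    = refl
breakpoints-Θ (suc (suc n)) =
  trans (breakpoints-extendΘ (proj₂ (proj₂ (Θ-last n))) (Θ-last-below n)) (cong suc (breakpoints-Θ (suc n)))

extBreakpoints-Θ : ∀ n → extBreakpoints (Θ (suc n)) ≡ suc n
extBreakpoints-Θ zero    = refl
extBreakpoints-Θ (suc n) =
  trans (extBreakpoints-lastBelow (proj₂ (proj₂ (Θ-last n))) (Θ-last-below n)) (cong suc (breakpoints-Θ (suc n)))

CleanCompact-Θ : ∀ n → CleanCompact (Θ n)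
CleanCompact-Θ zero    = []
CleanCompact-Θ (suc n) = breakpoints≡pred-length⇒CleanCompact (Θ (suc n)) (trans (breakpoints-Θ n) (cong pred (sym (length-Θ (suc n)))))

-- The chain Λ
extendΛ : Peg → Peg
extendΛ w = map shiftE w ++ (suc (suc (length w)) , dot) ∷ (1 , dot) ∷ []

length-extendΛ : ∀ w → length (extendΛ w) ≡ suc (suc (length w))
length-extendΛ w = trans (length-++ (map shiftE w)) (trans (cong (_+ 2) (length-map shiftE w)) (+-comm (length w) 2))

IsPeg-extendΛ : ∀ {w} → IsPeg w → IsPeg (extendΛ w)
IsPeg-extendΛ {w} w-peg = subst IsPeg rotated (IsPeg-rotate (IsPeg-∷ʳ {(1 , dot) ∷ map shiftE w} dot (IsPeg-1∷shift {w} dot w-peg)))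
  where
  rotated : (map shiftE w ++ [ (suc (suc (length (map shiftE w))) , dot) ]) ++ [ (1 , dot) ] ≡ extendΛ w
  rotated = trans (++-assoc (map shiftE w) _ _) (cong (λ n → map shiftE w ++ (suc (suc n) , dot) ∷ [ (1 , dot) ]) (length-map shiftE w))

ReachReversedIn : ℕ → Peg → Set
ReachReversedIn k w = ∃[ v ] IsSortedPeg v × Flips k w (flipRev v)

-- Once w is sorted, reversing all of shift w ++ [N , 1] but the final 1 yields a reversed sorted word.
Flips-extendΛ : ∀ {k w s} → Flips k w s → IsSortedPeg s → ReachReversedIn (k + 1) (extendΛ w)
Flips-extendΛ {k} {w} {s} fs s-sorted =
  (1 , dot) ∷ raised , sorted ,
  Flips-trans shifted (subst (Flips 1 (raised ++ [ (1 , dot) ])) (sym (flipRev-∷ (1 , dot) raised)) (flipPrefix raised [ (1 , dot) ]))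
  where
  N : ℕ
  N = suc (suc (length w))
  raised : Peg
  raised = map shiftE s ++ [ (N , dot) ]
  shifted : Flips k (extendΛ w) (raised ++ [ (1 , dot) ])
  shifted = subst (Flips k (extendΛ w)) (sym (++-assoc (map shiftE s) [ (N , dot) ] [ (1 , dot) ]))
                  (Flips-++ ((N , dot) ∷ (1 , dot) ∷ []) (Flips-map shiftE (λ _ → refl) fs))
  sorted : IsSortedPeg ((1 , dot) ∷ raised)
  sorted = subst (λ u → IsSortedPeg ((1 , dot) ∷ u))
                 (trans (map-++ shiftE s _) (cong (λ n → map shiftE s ++ [ (suc (suc n) , dot) ]) (Flips-length fs)))
                 (IsSortedPeg-1∷shift (λ ()) (IsSortedPeg-∷ʳ (λ ()) s-sorted))

ReachIn-extendΛ : ∀ {k w} → ReachIn k w → ReachIn (k + 2) (extendΛ w)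
ReachIn-extendΛ r with ReachIn⇒Flips r
... | k′ , s , k′≤k , fs , s-sorted with Flips-extendΛ fs s-sorted
... | v , v-sorted , fs′ =
  ReachIn-mono (≤-trans (≤-reflexive (+-assoc k′ 1 1)) (+-monoˡ-≤ 2 k′≤k))
    (Flips⇒ReachIn (Flips-trans fs′ (subst (Flips 1 (flipRev v)) (flipRev-involutive v) (flipAll (flipRev v)))) v-sorted)

ReachIn-extendΛ-short : ∀ m ρ → length ρ < suc m → ReachIn (m ∸ 1) ρ → ReachIn (suc m) (extendΛ ρ)
ReachIn-extendΛ-short zero    []      _ _ = step 2 (done (refl , (λ ()) ∷ (λ ()) ∷ []))
ReachIn-extendΛ-short zero    (_ ∷ _) (s≤s ()) _
ReachIn-extendΛ-short (suc m) ρ       _ r = ReachIn-mono (≤-reflexive (+-comm m 2)) (ReachIn-extendΛ r)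

breakpoints-extendΛ : ∀ {w u a d} → w ≡ u ++ [ (a , d) ] → a < length w → breakpoints (extendΛ w) ≡ suc (suc (breakpoints w))
breakpoints-extendΛ {w} {u} {a} {d} w≡ a<w = begin
  breakpoints (map shiftE w ++ top ∷ [ (1 , dot) ])                     ≡⟨ cong (λ v → breakpoints (v ++ top ∷ [ (1 , dot) ])) shifted ⟩
  breakpoints ((map shiftE u ++ [ (suc a , d) ]) ++ top ∷ [ (1 , dot) ]) ≡⟨ cong breakpoints (++-assoc (map shiftE u) [ (suc a , d) ] _) ⟩
  breakpoints (map shiftE u ++ (suc a , d) ∷ top ∷ [ (1 , dot) ])       ≡⟨ breakpoints-split (map shiftE u) (suc a , d) _ ⟩
  breakpoints (map shiftE u ++ [ (suc a , d) ]) + (breakpoint (suc a , d) top + (breakpoint top (1 , dot) + 0))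
    ≡⟨ cong₂ (λ b c → b + (c + (breakpoint top (1 , dot) + 0))) (cong breakpoints (sym shifted)) below-top ⟩
  breakpoints (map shiftE w) + (1 + (breakpoint top (1 , dot) + 0))     ≡⟨ cong (λ b → breakpoints (map shiftE w) + suc b) (trans (+-identityʳ _) top-1) ⟩
  breakpoints (map shiftE w) + 2                                        ≡⟨ trans (+-comm _ 2) (cong (λ b → suc (suc b)) (breakpoints-shift w)) ⟩
  suc (suc (breakpoints w))                                             ∎
  where
  open ≡-Reasoning
  top : Entry
  top = (suc (suc (length w)) , dot)
  shifted : map shiftE w ≡ map shiftE u ++ [ (suc a , d) ]
  shifted = trans (cong (map shiftE) w≡) (map-++ shiftE u _)
  below-top : breakpoint (suc a , d) top ≡ 1
  below-top = breakpoint-far (λ eq → <⇒≢ a<w (sym (suc-injective (suc-injective eq))))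
                             (λ eq → <⇒≢ (m<n⇒m<1+n (m<n⇒m<1+n a<w)) (suc-injective eq))
  top-1 : breakpoint top (1 , dot) ≡ 1
  top-1 = breakpoint-far (λ ()) (λ eq → n≮0 (subst (a <_) (suc-injective (suc-injective eq)) a<w))

-- Λ n is Λo n for odd n and Λe n for even n ≥ 2 (Λo≡Λ, Λe≡Λ).
Λ : ℕ → Peg
Λ zero                = []
Λ (suc zero)          = (1 , minus) ∷ []
Λ (suc (suc zero))    = (2 , plus) ∷ (1 , dot) ∷ []
Λ (suc (suc (suc n))) = extendΛ (Λ (suc n))

length-Λ : ∀ n → length (Λ n) ≡ n
length-Λ zero                = refl
length-Λ (suc zero)          = refl
length-Λ (suc (suc zero))    = refl
length-Λ (suc (suc (suc n))) = trans (length-extendΛ (Λ (suc n))) (cong (λ m → suc (suc m)) (length-Λ (suc n)))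

IsPeg-Λ : ∀ n → IsPeg (Λ n)
IsPeg-Λ zero                = ↭-refl
IsPeg-Λ (suc zero)          = ↭-refl
IsPeg-Λ (suc (suc zero))    = ↭-swap 2 1 ↭-refl
IsPeg-Λ (suc (suc (suc n))) = IsPeg-extendΛ (IsPeg-Λ (suc n))

ReachReversed-Λ : ∀ m → ReachReversedIn m (Λ (suc m))
ReachReversed-Λ zero          = (1 , plus) ∷ [] , (refl , (λ ()) ∷ []) , none
ReachReversed-Λ (suc zero)    = (1 , dot) ∷ (2 , plus) ∷ [] , (refl , (λ ()) ∷ (λ ()) ∷ []) , flip 1 (s≤s z≤n) none
ReachReversed-Λ (suc (suc m)) with ReachReversed-Λ m
... | v , v-sorted , fs with Flips-extendΛ (Flips-trans fs (subst (Flips 1 (flipRev v)) (flipRev-involutive v) (flipAll (flipRev v)))) v-sorted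
... | v′ , v′-sorted , fs′ =
  v′ , v′-sorted , subst (λ k → Flips k (Λ (suc (suc (suc m)))) (flipRev v′)) (trans (+-comm (m + 1) 1) (cong suc (+-comm m 1))) fs′

ReachIn-Λ : ∀ m → ReachIn (suc m) (Λ (suc m))
ReachIn-Λ m with ReachReversed-Λ m
... | v , v-sorted , fs =
  subst (λ k → ReachIn k (Λ (suc m))) (+-comm m 1)
        (Flips⇒ReachIn (Flips-trans fs (subst (Flips 1 (flipRev v)) (flipRev-involutive v) (flipAll (flipRev v)))) v-sorted)

ReachIn-shiftΛ-1 : ∀ m → ReachIn (suc m) (map shiftE (Λ (suc m)) ++ [ (1 , dot) ])
ReachIn-shiftΛ-1 m with ReachReversed-Λ m
... | v , v-sorted , fs =
  subst (λ k → ReachIn k (map shiftE (Λ (suc m)) ++ [ (1 , dot) ])) (+-comm m 1)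
        (Flips⇒ReachIn (Flips-trans shifted (subst (Flips 1 _) (flipRev-involutive _) (flipAll _)))
                       (IsSortedPeg-1∷shift (λ ()) v-sorted))
  where
  shifted : Flips m (map shiftE (Λ (suc m)) ++ [ (1 , dot) ]) (flipRev ((1 , dot) ∷ map shiftE v))
  shifted = subst (Flips m _) (trans (cong (_++ [ (1 , dot) ]) (flipRev-shift v)) (sym (flipRev-∷ (1 , dot) (map shiftE v))))
                  (Flips-++ [ (1 , dot) ] (Flips-map shiftE (λ _ → refl) fs))

Λ-last : ∀ n → ∃[ u ] ∃[ d ] Λ (suc n) ≡ u ++ [ (1 , d) ]
Λ-last zero          = [] , minus , refl
Λ-last (suc zero)    = (2 , plus) ∷ [] , dot , refl
Λ-last (suc (suc n)) = map shiftE (Λ (suc n)) ++ [ (suc (suc (length (Λ (suc n)))) , dot) ] , dot ,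
                       sym (++-assoc (map shiftE (Λ (suc n))) _ _)

Λ-last-below : ∀ n → 1 < length (Λ (suc (suc n)))
Λ-last-below n = subst (1 <_) (sym (length-Λ (suc (suc n)))) (s≤s (s≤s z≤n))

breakpoints-Λ : ∀ n → breakpoints (Λ (suc n)) ≡ n
breakpoints-Λ zero                = refl
breakpoints-Λ (suc zero)          = refl
breakpoints-Λ (suc (suc zero))    = refl
breakpoints-Λ (suc (suc (suc n))) =
  trans (breakpoints-extendΛ (proj₂ (proj₂ (Λ-last (suc n)))) (Λ-last-below n)) (cong (λ b → suc (suc b)) (breakpoints-Λ (suc n)))

extBreakpoints-Λ : ∀ n → extBreakpoints (Λ (suc (suc n))) ≡ suc (suc n)
extBreakpoints-Λ n =
  trans (extBreakpoints-lastBelow (proj₂ (proj₂ (Λ-last (suc n)))) (Λ-last-below n)) (cong suc (breakpoints-Λ (suc n)))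

CleanCompact-Λ : ∀ n → CleanCompact (Λ n)
CleanCompact-Λ zero    = []
CleanCompact-Λ (suc n) = breakpoints≡pred-length⇒CleanCompact (Λ (suc n)) (trans (breakpoints-Λ n) (cong pred (sym (length-Λ (suc n)))))

shift-bounds : ∀ {w} → IsPeg w → All (λ f → 1 < proj₁ f × proj₁ f < suc (suc (length w))) (map shiftE w)
shift-bounds w-peg = All.map⁺ (All.map (λ (1≤ , ≤w) → s≤s 1≤ , s≤s (s≤s ≤w)) (IsPeg-bounds w-peg))

-- The case of a pattern of Λ(m+3) = shift Λ(m+1) ++ [N , 1] using both N and 1: its last two
-- entries are its maximum and minimum, and the rest is a pattern of Λ(m+1).
Λ-patterns-extremes : ∀ m → (∀ ρ → IsPeg ρ → length ρ < suc m → ρ ↪ Λ (suc m) → ReachIn (m ∸ 1) ρ) →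
  ∀ Z₁ v₁ v₂ → let τ = Λ (suc m) ; σ₁ = map proj₁ Z₁ ; N = suc (suc (length τ)) in
  IsPeg (σ₁ ++ (v₁ , dot) ∷ (v₂ , dot) ∷ []) → length (σ₁ ++ (v₁ , dot) ∷ (v₂ , dot) ∷ []) < suc (suc (suc m)) →
  map proj₂ Z₁ ⊆ map shiftE τ → AllPairs SameOrder (Z₁ ++ ((v₁ , dot) , (N , dot)) ∷ ((v₂ , dot) , (1 , dot)) ∷ []) →
  All Compatible Z₁ → ReachIn (suc m) (σ₁ ++ (v₁ , dot) ∷ (v₂ , dot) ∷ [])
Λ-patterns-extremes m IH Z₁ v₁ v₂ σ-peg σ< Z₁⊆ ord comp₁
  with AllPairs-++⁻ Z₁ ord
... | ord₁ , ((max~min ∷ []) ∷ [] ∷ []) , across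
  with IsPeg-maxMin⁻ σ-peg (between-extremes (shift-bounds (IsPeg-Λ (suc m))) Z₁⊆ across)
                     (Equivalence.from (proj₂ max~min) (s≤s (s≤s z≤n)))
... | refl , refl , ρ-peg =
  subst (ReachIn (suc m)) extended (ReachIn-extendΛ-short m ρ ρ< (IH ρ ρ-peg ρ< (↪-unshift (embedding Z₁ refl Z₁⊆ ord₁ comp₁) σ₁₊)))
  where
  σ₁ ρ : Peg
  σ₁ = map proj₁ Z₁
  ρ  = map unshiftE σ₁
  σ₁₊ : All Positive σ₁
  σ₁₊ = All.++⁻ˡ σ₁ (All.map proj₁ (IsPeg-bounds {σ₁ ++ (suc (suc (length σ₁)) , dot) ∷ (1 , dot) ∷ []} σ-peg))
  ρ< : length ρ < suc m
  ρ< = subst (_< suc m) (sym (length-map unshiftE σ₁))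
         (≤-pred (≤-pred (subst (_< suc (suc (suc m))) (trans (length-++-sucʳ σ₁ _ _) (cong suc (length-∷ʳ σ₁ _))) σ<)))
  extended : extendΛ ρ ≡ σ₁ ++ (suc (suc (length σ₁)) , dot) ∷ (1 , dot) ∷ []
  extended = cong₂ (λ u n → u ++ (suc (suc n) , dot) ∷ (1 , dot) ∷ []) (map-shift-unshift σ₁₊) (length-map unshiftE σ₁)

Λ-patterns-step : ∀ m → (∀ ρ → IsPeg ρ → length ρ < suc m → ρ ↪ Λ (suc m) → ReachIn (m ∸ 1) ρ) →
                  ∀ σ → IsPeg σ → length σ < suc (suc (suc m)) → σ ↪ Λ (suc (suc (suc m))) → ReachIn (suc m) σ
Λ-patterns-step m IH _ σ-peg σ< (embedding Z refl Z⊆ ord comp)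
  with split-⊆-++ proj₂ Z (map shiftE (Λ (suc m))) _ Z⊆
... | Z₁ , Z₂ , refl , Z₁⊆ , Z₂⊆ with ⊆-pair proj₂ Z₂ Z₂⊆
... | inj₁ Z₂⊆top =
  ReachIn-↪ (↪-unshiftTarget (embedding (Z₁ ++ Z₂) refl target ord comp)) σ-peg (ReachIn-∷ʳ (λ ()) (ReachIn-Λ m))
  where
  target : map proj₂ (Z₁ ++ Z₂) ⊆ map shiftE (Λ (suc m) ++ [ (suc (length (Λ (suc m))) , dot) ])
  target = subst₂ _⊆_ (sym (map-++ proj₂ Z₁ Z₂)) (sym (map-++ shiftE (Λ (suc m)) _)) (Sub.++⁺ Z₁⊆ Z₂⊆top)
... | inj₂ (inj₁ (x , refl , refl)) =
  ReachIn-↪ (embedding (Z₁ ++ [ x ]) refl target ord comp) σ-peg (ReachIn-shiftΛ-1 m)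
  where
  target : map proj₂ (Z₁ ++ [ x ]) ⊆ map shiftE (Λ (suc m)) ++ [ (1 , dot) ]
  target = subst (_⊆ _) (sym (map-++ proj₂ Z₁ [ x ])) (Sub.++⁺ Z₁⊆ (refl ∷ []))
... | inj₂ (inj₂ (((v₁ , δ₁) , _) , ((v₂ , δ₂) , _) , refl , refl , refl))
  with All.++⁻ʳ Z₁ comp
... | c₁ ∷ c₂ ∷ [] with DecoCompat-dot c₁ | DecoCompat-dot c₂
... | refl | refl =
  subst (ReachIn (suc m)) (sym (map-++ proj₁ Z₁ _))
    (Λ-patterns-extremes m IH Z₁ v₁ v₂ (subst IsPeg (map-++ proj₁ Z₁ _) σ-peg)
       (subst (λ u → length u < suc (suc (suc m))) (map-++ proj₁ Z₁ _) σ<) Z₁⊆ ord (All.++⁻ˡ Z₁ comp))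

Λ-patterns : ∀ n σ → IsPeg σ → length σ < n → σ ↪ Λ n → ReachIn (n ∸ 2) σ
Λ-patterns (suc zero)          []          _     _                _  = done IsSortedPeg-[]
Λ-patterns (suc zero)          (_ ∷ _)     _     (s≤s ())         _
Λ-patterns (suc (suc zero))    []          _     _                _  = done IsSortedPeg-[]
Λ-patterns (suc (suc zero))    (e ∷ [])    σ-peg _                σ↪ =
  done (Perm.↭-singleton-inv σ-peg , ↪-NotMinus σ↪ ((λ ()) ∷ (λ ()) ∷ []))
Λ-patterns (suc (suc zero))    (_ ∷ _ ∷ _) _     (s≤s (s≤s ()))   _
Λ-patterns (suc (suc (suc m))) = Λ-patterns-step m (Λ-patterns (suc m))

-- Closed forms of the exceptional permutations
flipRev-applyUpTo-dot : ∀ (g : ℕ → ℕ) t → flipRev (applyUpTo (λ j → (g j , dot)) t) ≡ applyUpTo (λ j → (g (t ∸ suc j) , dot)) t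
flipRev-applyUpTo-dot g t =
  trans (cong reverse (map-applyUpTo (λ j → (g j , dot)) flipE t))
        (trans (reverse-applyUpTo (λ j → (g j , dot)) t) (applyDownFrom≡applyUpTo (λ j → (g j , dot)) t))

-- Θe, Θo, Λe, Λo as functions of ⌊ n /2⌋: e.g. Θe n ≡ Θe′ ⌊ n /2⌋ holds by definition.
Θe′ : ℕ → Peg
Θe′ t = applyUpTo (λ j → (2 * (t ∸ j) , dot)) t ++ (1 , plus) ∷ applyUpTo (λ j → (2 * j + 3 , dot)) (t ∸ 1)

Θo′ : ℕ → Peg
Θo′ s = applyUpTo (λ j → (2 * (s ∸ j) + 1 , dot)) s ++ (1 , minus) ∷ applyUpTo (λ j → (2 * j + 2 , dot)) s

Λe′ : ℕ → Peg
Λe′ t = (suc t , plus) ∷ (t , dot) ∷ concatMap (λ j → (t + suc (suc j) , dot) ∷ (t ∸ suc j , dot) ∷ []) (upTo (t ∸ 1))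

Λo′ : ℕ → Peg
Λo′ s = (suc s , minus) ∷ concatMap (λ j → (suc s + suc j , dot) ∷ (suc s ∸ suc j , dot) ∷ []) (upTo s)

Θe′-suc : ∀ t → Θe′ (suc t) ≡ (suc (suc (t + t)) , dot) ∷ flipRev (Θo′ t)
Θe′-suc t = begin
  (2 * suc t , dot) ∷ (applyUpTo (λ j → (2 * (t ∸ j) , dot)) t ++ (1 , plus) ∷ applyUpTo (λ j → (2 * j + 3 , dot)) t)
    ≡⟨ cong₂ (λ a u → (a , dot) ∷ u) (2*[1+n]≡2+n+n t) (cong₂ (λ u w → u ++ (1 , plus) ∷ w) evens odds) ⟩
  (suc (suc (t + t)) , dot) ∷ (flipRev D ++ (1 , plus) ∷ flipRev C)
    ≡⟨ cong ((suc (suc (t + t)) , dot) ∷_) (sym (flipRev-middle C (1 , minus) D)) ⟩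
  (suc (suc (t + t)) , dot) ∷ flipRev (Θo′ t) ∎
  where
  open ≡-Reasoning
  C D : Peg
  C = applyUpTo (λ j → (2 * (t ∸ j) + 1 , dot)) t
  D = applyUpTo (λ j → (2 * j + 2 , dot)) t
  evens : applyUpTo (λ j → (2 * (t ∸ j) , dot)) t ≡ flipRev D
  evens = trans (applyUpTo-cong< t (λ j j<t → cong (_, dot) (trans (cong (2 *_) (+-∸-assoc 1 j<t)) (2*[1+n]≡2*n+2 (t ∸ suc j)))))
                (sym (flipRev-applyUpTo-dot (λ j → 2 * j + 2) t))
  odds : applyUpTo (λ j → (2 * j + 3 , dot)) t ≡ flipRev C
  odds = trans (applyUpTo-cong< t (λ j j<t → cong (_, dot) (trans (sym (2*[1+n]+1≡2*n+3 j)) (cong (λ x → 2 * x + 1) (sym (m∸[m∸n]≡n j<t))))))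
               (sym (flipRev-applyUpTo-dot (λ j → 2 * (t ∸ j) + 1) t))

Θo′-suc : ∀ t → Θo′ (suc t) ≡ (suc (suc (suc (t + t))) , dot) ∷ flipRev (Θe′ (suc t))
Θo′-suc t = begin
  (2 * suc t + 1 , dot) ∷ (applyUpTo (λ j → (2 * (t ∸ j) + 1 , dot)) t ++ (1 , minus) ∷ applyUpTo (λ j → (2 * j + 2 , dot)) (suc t))
    ≡⟨ cong₂ (λ a u → (a , dot) ∷ u) top (cong₂ (λ u w → u ++ (1 , minus) ∷ w) odds evens) ⟩
  (suc (suc (suc (t + t))) , dot) ∷ (flipRev B ++ (1 , minus) ∷ flipRev A)
    ≡⟨ cong ((suc (suc (suc (t + t))) , dot) ∷_) (sym (flipRev-middle A (1 , plus) B)) ⟩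
  (suc (suc (suc (t + t))) , dot) ∷ flipRev (Θe′ (suc t)) ∎
  where
  open ≡-Reasoning
  A B : Peg
  A = applyUpTo (λ j → (2 * (suc t ∸ j) , dot)) (suc t)
  B = applyUpTo (λ j → (2 * j + 3 , dot)) t
  top : 2 * suc t + 1 ≡ suc (suc (suc (t + t)))
  top = trans (cong (_+ 1) (2*[1+n]≡2+n+n t)) (+-comm _ 1)
  odds : applyUpTo (λ j → (2 * (t ∸ j) + 1 , dot)) t ≡ flipRev B
  odds = trans (applyUpTo-cong< t (λ j j<t → cong (_, dot) (trans (cong (λ x → 2 * x + 1) (+-∸-assoc 1 j<t)) (2*[1+n]+1≡2*n+3 (t ∸ suc j)))))
               (sym (flipRev-applyUpTo-dot (λ j → 2 * j + 3) t))
  evens : applyUpTo (λ j → (2 * j + 2 , dot)) (suc t) ≡ flipRev A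
  evens = trans (applyUpTo-cong< (suc t) (λ j j<t → cong (_, dot) (trans (sym (2*[1+n]≡2*n+2 j)) (cong (2 *_) (sym (m∸[m∸n]≡n j<t))))))
                (sym (flipRev-applyUpTo-dot (λ j → 2 * (suc t ∸ j)) (suc t)))

mutual
  Θe′≡Θ : ∀ t → Θe′ (suc t) ≡ Θ (suc t + suc t)
  Θe′≡Θ t = begin
    Θe′ (suc t)                                           ≡⟨ Θe′-suc t ⟩
    (suc (suc (t + t)) , dot) ∷ flipRev (Θo′ t)           ≡⟨ cong (λ w → (suc (suc (t + t)) , dot) ∷ flipRev w) (Θo′≡Θ t) ⟩
    (suc (suc (t + t)) , dot) ∷ flipRev (Θ (suc (t + t)))
      ≡⟨ cong (λ n → (suc n , dot) ∷ flipRev (Θ (suc (t + t)))) (sym (length-Θ (suc (t + t)))) ⟩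
    Θ (suc (suc (t + t)))                                 ≡⟨ cong (λ n → Θ (suc n)) (sym (+-suc t t)) ⟩
    Θ (suc t + suc t)                                     ∎
    where open ≡-Reasoning

  Θo′≡Θ : ∀ t → Θo′ t ≡ Θ (suc (t + t))
  Θo′≡Θ zero    = refl
  Θo′≡Θ (suc t) = begin
    Θo′ (suc t)                                                ≡⟨ Θo′-suc t ⟩
    (suc (suc (suc (t + t))) , dot) ∷ flipRev (Θe′ (suc t))    ≡⟨ cong (λ w → (suc (suc (suc (t + t))) , dot) ∷ flipRev w) (Θe′≡Θ t) ⟩
    (suc (suc (suc (t + t))) , dot) ∷ flipRev (Θ (suc t + suc t))
      ≡⟨ cong (λ n → (suc n , dot) ∷ flipRev (Θ (suc t + suc t))) (sym (trans (length-Θ (suc t + suc t)) (cong suc (+-suc t t)))) ⟩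
    Θ (suc (suc t + suc t))                                    ∎
    where open ≡-Reasoning

Λe′-suc : ∀ t → Λe′ (suc (suc t)) ≡ map shiftE (Λe′ (suc t)) ++ (suc (suc (suc (suc (t + t)))) , dot) ∷ (1 , dot) ∷ []
Λe′-suc t = cong (λ u → (suc (suc (suc t)) , plus) ∷ (suc (suc t) , dot) ∷ u) pairs
  where
  inner outer : ℕ → Peg
  inner j = (suc t + suc (suc j) , dot) ∷ (suc t ∸ suc j , dot) ∷ []
  outer j = (suc (suc t) + suc (suc j) , dot) ∷ (suc (suc t) ∸ suc j , dot) ∷ []
  pairs : concatMap outer (upTo (suc t)) ≡ map shiftE (concatMap inner (upTo t)) ++ (suc (suc (suc (suc (t + t)))) , dot) ∷ (1 , dot) ∷ []
  pairs = trans (concatMap-upTo-∷ʳ outer t) (cong₂ _++_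
    (trans (concatMap-upTo-cong< t (λ j j<t → cong (λ x → (suc (suc t) + suc (suc j) , dot) ∷ (x , dot) ∷ []) (+-∸-assoc 1 (m<n⇒m<1+n j<t))))
           (sym (map-concatMap shiftE inner (upTo t))))
    (cong₂ (λ a b → (a , dot) ∷ (b , dot) ∷ []) (cong (λ n → suc (suc n)) (trans (+-suc t (suc t)) (cong suc (+-suc t t)))) (m+n∸n≡m 1 t)))

Λo′-suc : ∀ t → Λo′ (suc t) ≡ map shiftE (Λo′ t) ++ (suc (suc (suc (t + t))) , dot) ∷ (1 , dot) ∷ []
Λo′-suc t = cong ((suc (suc t) , minus) ∷_) pairs
  where
  inner outer : ℕ → Peg
  inner j = (suc t + suc j , dot) ∷ (suc t ∸ suc j , dot) ∷ []
  outer j = (suc (suc t) + suc j , dot) ∷ (suc (suc t) ∸ suc j , dot) ∷ []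
  pairs : concatMap outer (upTo (suc t)) ≡ map shiftE (concatMap inner (upTo t)) ++ (suc (suc (suc (t + t))) , dot) ∷ (1 , dot) ∷ []
  pairs = trans (concatMap-upTo-∷ʳ outer t) (cong₂ _++_
    (trans (concatMap-upTo-cong< t (λ j j<t → cong (λ x → (suc (suc t) + suc j , dot) ∷ (x , dot) ∷ []) (+-∸-assoc 1 (m<n⇒m<1+n j<t))))
           (sym (map-concatMap shiftE inner (upTo t))))
    (cong₂ (λ a b → (a , dot) ∷ (b , dot) ∷ []) (cong (λ n → suc (suc n)) (+-suc t t)) (m+n∸n≡m 1 t)))

Λe′≡Λ : ∀ t → Λe′ (suc t) ≡ Λ (suc t + suc t)
Λe′≡Λ zero    = refl
Λe′≡Λ (suc t) = begin
  Λe′ (suc (suc t))                                                         ≡⟨ Λe′-suc t ⟩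
  map shiftE (Λe′ (suc t)) ++ (suc (suc (suc (suc (t + t)))) , dot) ∷ [ (1 , dot) ]
    ≡⟨ cong₂ (λ w n → map shiftE w ++ (suc (suc n) , dot) ∷ [ (1 , dot) ]) (Λe′≡Λ t) (sym top) ⟩
  extendΛ (Λ (suc t + suc t))                                               ≡⟨ cong (λ n → Λ (suc (suc n))) (sym (+-suc t (suc t))) ⟩
  Λ (suc (suc t) + suc (suc t))                                             ∎
  where
  open ≡-Reasoning
  top : length (Λ (suc t + suc t)) ≡ suc (suc (t + t))
  top = trans (length-Λ (suc t + suc t)) (cong suc (+-suc t t))

Λo′≡Λ : ∀ t → Λo′ t ≡ Λ (suc (t + t))
Λo′≡Λ zero    = refl
Λo′≡Λ (suc t) = begin
  Λo′ (suc t)                                                         ≡⟨ Λo′-suc t ⟩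
  map shiftE (Λo′ t) ++ (suc (suc (suc (t + t))) , dot) ∷ [ (1 , dot) ]
    ≡⟨ cong₂ (λ w n → map shiftE w ++ (suc (suc n) , dot) ∷ [ (1 , dot) ]) (Λo′≡Λ t) (sym (length-Λ (suc (t + t)))) ⟩
  extendΛ (Λ (suc (t + t)))                                           ≡⟨ cong (λ n → Λ (suc (suc n))) (sym (+-suc t t)) ⟩
  Λ (suc (suc t + suc t))                                             ∎
  where open ≡-Reasoning

Θe≡Θ : ∀ t → Θe (suc t + suc t) ≡ Θ (suc t + suc t)
Θe≡Θ t = trans (cong Θe′ (sym (n≡⌊n+n/2⌋ (suc t)))) (Θe′≡Θ t)

Θo≡Θ : ∀ t → Θo (suc (t + t)) ≡ Θ (suc (t + t))
Θo≡Θ t = trans (cong Θo′ (sym (n≡⌈n+n/2⌉ t))) (Θo′≡Θ t)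

Λe≡Λ : ∀ t → Λe (suc t + suc t) ≡ Λ (suc t + suc t)
Λe≡Λ t = trans (cong Λe′ (sym (n≡⌊n+n/2⌋ (suc t)))) (Λe′≡Λ t)

Λo≡Λ : ∀ t → Λo (suc (t + t)) ≡ Λ (suc (t + t))
Λo≡Λ t = trans (cong Λo′ (sym (n≡⌈n+n/2⌉ t))) (Λo′≡Λ t)

InBothBases : ℕ → Peg → Set
InBothBases k π = InCCBasis k π × InCCBasis (k + 1) π

-- k + 2 breakpoints rule out sorting π with k + 1 reversals, while every proper pattern needs at most k.
inBothBases : ∀ k π → IsPeg π → CleanCompact π → extBreakpoints π ≡ suc (suc k) →
              (∀ σ → IsPeg σ → length σ < length π → σ ↪ π → ReachIn k σ) → InBothBases k π
inBothBases k π π-peg π-clean π-breaks patterns = inBasis k ≤-refl (n≤1+n k) , inBasis (k + 1) (m≤m+n k 1) (≤-reflexive (+-comm k 1))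
  where
  inBasis : ∀ j → k ≤ j → j ≤ suc k → InCCBasis j π
  inBasis j k≤j j≤k+1 =
    π-peg , π-clean ,
    (λ (_ , r) → <-irrefl π-breaks (s≤s (≤-trans (ReachIn⇒extBreakpoints≤ r) j≤k+1))) ,
    (λ σ σ-peg _ σ< σ≼π → σ-peg , ReachIn-mono k≤j (patterns σ σ-peg σ< (≼⇒↪ σ≼π)))

Θ-inBothBases : ∀ k → InBothBases k (Θ (suc (suc k)))
Θ-inBothBases k = inBothBases k (Θ (suc (suc k))) (IsPeg-Θ (suc (suc k))) (CleanCompact-Θ (suc (suc k))) (extBreakpoints-Θ (suc k))
  (λ σ σ-peg σ< → Θ-patterns (suc (suc k)) σ σ-peg (subst (length σ <_) (length-Θ (suc (suc k))) σ<))

Λ-inBothBases : ∀ k → InBothBases k (Λ (suc (suc k)))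
Λ-inBothBases k = inBothBases k (Λ (suc (suc k))) (IsPeg-Λ (suc (suc k))) (CleanCompact-Λ (suc (suc k))) (extBreakpoints-Λ k)
  (λ σ σ-peg σ< → Λ-patterns (suc (suc k)) σ σ-peg (subst (length σ <_) (length-Λ (suc (suc k))) σ<))

half-even : ∀ n → n % 2 ≡ 0 → n ≡ n / 2 + n / 2
half-even n n-even = trans (m≡m%n+[m/n]*n n 2) (trans (cong (_+ n / 2 * 2) n-even) (trans (*-comm (n / 2) 2) (2*n≡n+n (n / 2))))

half-odd : ∀ n → n % 2 ≡ 1 → n ≡ suc (n / 2 + n / 2)
half-odd n n-odd = trans (m≡m%n+[m/n]*n n 2) (trans (cong (_+ n / 2 * 2) n-odd) (cong suc (trans (*-comm (n / 2) 2) (2*n≡n+n (n / 2)))))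

k+2-even : ∀ k → (k + 2) % 2 ≡ 0 → k + 2 ≡ suc (k / 2) + suc (k / 2)
k+2-even k even = begin
  k + 2                     ≡⟨ cong (_+ 2) (half-even k (trans (sym ([m+n]%n≡m%n k 2)) even)) ⟩
  k / 2 + k / 2 + 2         ≡⟨ +-comm _ 2 ⟩
  suc (suc (k / 2 + k / 2)) ≡⟨ cong suc (sym (+-suc (k / 2) (k / 2))) ⟩
  suc (k / 2) + suc (k / 2) ∎
  where open ≡-Reasoning

k+2-odd : ∀ k → (k + 2) % 2 ≡ 1 → k + 2 ≡ suc (suc (k / 2) + suc (k / 2))
k+2-odd k odd = begin
  k + 2                           ≡⟨ cong (_+ 2) (half-odd k (trans (sym ([m+n]%n≡m%n k 2)) odd)) ⟩
  suc (k / 2 + k / 2) + 2         ≡⟨ +-comm _ 2 ⟩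
  suc (suc (suc (k / 2 + k / 2))) ≡⟨ cong (λ n → suc (suc n)) (sym (+-suc (k / 2) (k / 2))) ⟩
  suc (suc (k / 2) + suc (k / 2)) ∎
  where open ≡-Reasoning

InBothBases-≡ : ∀ k (f g : ℕ → Peg) {n} → k + 2 ≡ n → f n ≡ g n → InBothBases k (g (suc (suc k))) → InBothBases k (f (k + 2))
InBothBases-≡ k f g k+2≡n fn≡gn =
  subst (InBothBases k) (sym (trans (cong f k+2≡n) (trans fn≡gn (cong g (trans (sym k+2≡n) (+-comm k 2))))))

mainTheorem18 : (k : ℕ) →
    ((k + 2) % 2 ≡ 0 →
      (InCCBasis k (Θe (k + 2)) × InCCBasis (k + 1) (Θe (k + 2))) ×
      (InCCBasis k (Λe (k + 2)) × InCCBasis (k + 1) (Λe (k + 2)))) ×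
    ((k + 2) % 2 ≡ 1 →
      (InCCBasis k (Θo (k + 2)) × InCCBasis (k + 1) (Θo (k + 2))) ×
      (InCCBasis k (Λo (k + 2)) × InCCBasis (k + 1) (Λo (k + 2))))
mainTheorem18 k =
  (λ even → InBothBases-≡ k Θe Θ (k+2-even k even) (Θe≡Θ (k / 2)) (Θ-inBothBases k) ,
            InBothBases-≡ k Λe Λ (k+2-even k even) (Λe≡Λ (k / 2)) (Λ-inBothBases k)) ,
  (λ odd  → InBothBases-≡ k Θo Θ (k+2-odd k odd) (Θo≡Θ (suc (k / 2))) (Θ-inBothBases k) ,
            InBothBases-≡ k Λo Λ (k+2-odd k odd) (Λo≡Λ (suc (k / 2))) (Λ-inBothBases k))
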